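{- Let $k\in\mathbb{Z}$, $n \geq 1$ and $1 \leq j \leq n$. Then \begin{equation*} \begin{split} &\sum_{m=j}^{n}\frac{\binom{m}{j}}{(m-j+1)^{k}}S_{1}(n,m)\\ &=\sum_{l=0}^{n-j}\sum_{l_{1}+\cdots + l_{n}=l}\binom{n-1}{l_{1},\cdots , l_{n},n-1-l}\binom{n-l}{j}\frac{ B_{l_{1}} \cdots B_{l_{n}}}{(n-l-j+1)^k}\\ &=(-1)^{n+j} n! \sum_{a=j}^{n}\sum_{l=j-1}^{a-1}\frac{(-1)^{l+1-j}}{a!}\binom{n-1}{a-1}\binom{a-1}{l}\binom{l+1}{j}\frac{B_{a-1-l}^{(a)}}{(l+2-j)^{k}}. \end{split} \end{equation*} Moreover, for $k\in\mathbb{Z}$ and $n\ge 1$, \begin{equation*} \begin{split} C_{n}^{(k)}&=\sum_{m=0}^{n}\frac{S_{1}(n,m)}{(m+1)^{k}}=\sum_{l=0}^{n-1}\sum_{l_{1}+\cdots + l_{n}=l}\binom{n-1}{l_{1},\cdots , l_{n},n-1-l}\frac{ B_{l_{1}} \cdots B_{l_{n}}}{(n-l+1)^k}\\ &=(-1)^n n! \sum_{a=1}^{n}\sum_{l=0}^{a-1}\frac{(-1)^{l+1}}{a!}\binom{n-1}{a-1}\binom{a-1}{l}\frac{B_{a-1-l}^{(a)}}{(l+2)^{k}}. \end{split} \end{equation*} Here the sums over $l_1+\cdots+l_n=l$ run over $n$-tuples of nonnegative integers.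
   Context: For $k\in\mathbb{Z}$, $Lif_k(t)=\sum_{m=0}^{\infty}\frac{t^m}{m!(m+1)^k}$, and the poly-Cauchy polynomials $C_n^{(k)}(x)$ are defined by $\frac{Lif_k(\log(1+t))}{(1+t)^x}=\sum_{n=0}^\infty C_n^{(k)}(x)\frac{t^n}{n!}$; the poly-Cauchy numbers are $C_n^{(k)}=C_n^{(k)}(0)$. The (signed) Stirling numbers of the first kind $S_1(l,m)$ are defined by $(\log(1+t))^m=m!\sum_{l\ge m}S_1(l,m)\frac{t^l}{l!}$, equivalently $x(x-1)\cdots(x-n+1)=\sum_{l=0}^n S_1(n,l)x^l$. $B_l$ is the $l$-th Bernoulli number ($\frac{t}{e^t-1}=\sum B_l t^l/l!$), and the Bernoulli numbers of order $a$ are given by $\left(\frac{t}{e^t-1}\right)^a=\sum_{n\ge0}B_n^{(a)}\frac{t^n}{n!}$. The multinomial coefficient is $\binom{n-1}{l_1,\dots,l_n,n-1-l}=\frac{(n-1)!}{l_1!\cdots l_n!(n-1-l)!}$. -}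

module Defs where

open import Data.Nat as ℕ using (ℕ; zero; suc; _∸_; _!)
open import Data.Nat.Combinatorics using (_C_)
open import Data.Integer as ℤ using (ℤ; +_; -[1+_])
open import Data.Rational using (ℚ; 0ℚ; 1ℚ; _+_; _*_; -_; _/_)
open import Data.List using (List; []; _∷_; map; foldr; upTo; zipWith; length; concatMap)

ℕ→ℚ : ℕ → ℚ
ℕ→ℚ n = + n / 1

-- a / d for a positive natural d  (returns 0 for d = 0; only ever used
-- with d > 0 below)
_÷ℕ_ : ℤ → ℕ → ℚ
a ÷ℕ zero    = 0ℚ
a ÷ℕ (suc d) = a / suc d

_^ℚ_ : ℚ → ℕ → ℚ
q ^ℚ zero  = 1ℚ
q ^ℚ suc n = q * (q ^ℚ n)

sgn : ℕ → ℚ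
sgn e = (- 1ℚ) ^ℚ e

recipPow : ℕ → ℤ → ℚ
recipPow b (+ n)     = (+ 1) ÷ℕ (b ℕ.^ n)
recipPow b -[1+ n ]  = ℕ→ℚ (b ℕ.^ suc n)

sumℚ : List ℚ → ℚ
sumℚ = foldr _+_ 0ℚ

prodℚ : List ℚ → ℚ
prodℚ = foldr _*_ 1ℚ

-- Σ_{i=a}^{b} f i   (empty if b < a)
range : ℕ → ℕ → List ℕ
range a b = map (a ℕ.+_) (upTo (suc b ∸ a))

Σ[_⋯_] : ℕ → ℕ → (ℕ → ℚ) → ℚ
Σ[ a ⋯ b ] f = sumℚ (map f (range a b))

PS : Set
PS = ℕ → ℚ

onePS : PS
onePS zero    = 1ℚ
onePS (suc n) = 0ℚ

_⊛_ : PS → PS → PS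
(f ⊛ g) n = Σ[ 0 ⋯ n ] (λ i → f i * g (n ∸ i))

_^PS_ : PS → ℕ → PS
f ^PS zero  = onePS
f ^PS suc a = f ⊛ (f ^PS a)

-- composition f(g(t)); valid for g 0 = 0 (then g^m has order ≥ m)
_∘PS_ : PS → PS → PS
(f ∘PS g) n = Σ[ 0 ⋯ n ] (λ m → f m * (g ^PS m) n)

-- multiplicative inverse of a series f with f 0 = 1:
-- g 0 = 1, g (n+1) = - Σ_{i=0}^{n} f (i+1) g (n-i).
-- invRev f n = [g n, g (n-1), …, g 0]
invRev : PS → ℕ → List ℚ
invRev f zero    = 1ℚ ∷ []
invRev f (suc n) =
  let gs = invRev f n in
  (- sumℚ (zipWith (λ i g → f (suc i) * g) (upTo (suc n)) gs)) ∷ gs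

headℚ : List ℚ → ℚ
headℚ []      = 0ℚ
headℚ (x ∷ _) = x

invPS : PS → PS
invPS f n = headℚ (invRev f n)

expm1OverT : PS
expm1OverT n = (+ 1) ÷ℕ (suc n !)

bernoulliGF : PS
bernoulliGF = invPS expm1OverT

-- Bernoulli numbers, t/(e^t-1) = Σ B_l t^l / l!   (so B₁ = -1/2)
B : ℕ → ℚ
B l = ℕ→ℚ (l !) * bernoulliGF l

-- Bernoulli numbers of order a: (t/(e^t-1))^a = Σ B_n^{(a)} t^n/n!
Bord : ℕ → ℕ → ℚ
Bord n a = ℕ→ℚ (n !) * (bernoulliGF ^PS a) n

log1p : PS
log1p zero    = 0ℚ
log1p (suc i) = sgn i * ((+ 1) ÷ℕ suc i)

Lif : ℤ → PS
Lif k m = ((+ 1) ÷ℕ (m !)) * recipPow (suc m) k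

-- poly-Cauchy numbers: Lif_k(log(1+t)) = Σ C_n^{(k)} t^n/n!
-- (the x = 0 case of the poly-Cauchy polynomials, (1+t)^0 = 1)
polyCauchy : ℕ → ℤ → ℚ
polyCauchy n k = ℕ→ℚ (n !) * (Lif k ∘PS log1p) n

-- signed Stirling numbers of the first kind:
-- x(x-1)…(x-n+1) = Σ_l S₁(n,l) x^l,
-- i.e. S₁(0,0)=1, S₁(0,m+1)=0, S₁(n+1,0)=0, S₁(n+1,m+1)=S₁(n,m) - n S₁(n,m+1)
S₁ : ℕ → ℕ → ℤ
S₁ zero    zero    = + 1
S₁ zero    (suc m) = + 0
S₁ (suc n) zero    = + 0
S₁ (suc n) (suc m) = S₁ n m ℤ.- (+ n) ℤ.* S₁ n (suc m)

S₁ℚ : ℕ → ℕ → ℚ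
S₁ℚ n m = S₁ n m / 1

tuples : ℕ → ℕ → List (List ℕ)
tuples zero    zero    = [] ∷ []
tuples zero    (suc l) = []
tuples (suc n) l =
  concatMap (λ i → map (i ∷_) (tuples n (l ∸ i))) (upTo (suc l))

Σtuples : ℕ → ℕ → (List ℕ → ℚ) → ℚ
Σtuples n l F = sumℚ (map F (tuples n l))

multinom : ℕ → ℕ → List ℕ → ℚ
multinom n l ls =
  (+ ((n ∸ 1) !)) ÷ℕ (foldr (λ x r → (x !) ℕ.* r) 1 ls ℕ.* ((n ∸ 1 ∸ l) !))

prodB : List ℕ → ℚ
prodB ls = prodℚ (map B ls)

binℚ : ℕ → ℕ → ℚ
binℚ n k = ℕ→ℚ (n C k)

module Submission where

-- Write β = t/(e^t-1), L = log(1+t), [tⁿ] for coefficients, S₁ for the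
-- Stirling numbers of the first kind.  Everything rests on two facts:
--   (N) Nörlund: (n-1)! [t^(n-m)] βⁿ = (m-1)! S₁(n,m) for 1 ≤ m ≤ n, proved
--       by induction from the differential equation t β' = β - β² - tβ;
--   (L) Lah inversion: Σₐ L(n,a) S₁(a,m) = (-1)^(n+m) S₁(n,m), with the Lah
--       numbers L(n,a) = n!/a! C(n-1,a-1).
-- Expanding βⁿ as an n-fold product turns (N) into the multinomial sums over
-- tuples; (N) read as C(a-1,l) B^(a)_(a-1-l) = S₁(a,l+1), combined with (L),
-- gives the double sums; and n! [tⁿ] Lᵐ = m! S₁(n,m) gives C_n^(k).

open import Defs
open import Data.Nat using (ℕ; _≤_; _∸_; _!)
open import Data.Nat using () renaming (_+_ to _+ℕ_)
open import Data.Integer using (ℤ; +_)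
open import Data.Rational using (ℚ; _*_)
open import Data.Product using (_×_)
open import Relation.Binary.PropositionalEquality using (_≡_)

open import Data.Nat as ℕ using (zero; suc; _<_; z≤n; s≤s; NonZero) renaming (_*_ to _*ℕ_)
import Data.Nat.Properties as ℕP
open import Data.Nat.Combinatorics using (_C_; nCk≡n!/k![n-k]!; k![n∸k]!∣n!)
open import Data.Nat.DivMod using (m/n*n≡m)
import Data.Integer as ℤ
import Data.Integer.Properties as ℤP
open import Data.Rational using (0ℚ; 1ℚ; _+_; -_; _/_; toℚᵘ; fromℚᵘ)
open import Data.Rational.Properties
open import Data.Rational.Unnormalised as U using (mkℚᵘ)
import Data.Rational.Unnormalised.Properties as UP
open import Data.Rational.Solver using (module +-*-Solver)
open +-*-Solver
open import Data.List using (List; []; _∷_; map; foldr; upTo; applyUpTo; zipWith; concatMap; _++_)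
open import Data.List.Properties using (map-upTo; map-applyUpTo)
open import Data.Product using (_,_)
open import Function using (_∘_)
open import Relation.Binary.PropositionalEquality using (refl; sym; trans; cong; cong₂; subst; _≗_; module ≡-Reasoning)
open import Data.Nat.Tactic.RingSolver using (solve-∀)

-- The normalising constructor _/_ is fromℚᵘ on unnormalised fractions, and
-- fromℚᵘ is a ring homomorphism; this gives arithmetic on fractions a / d.
private
  fromℚᵘ-homo-+ : ∀ p q → fromℚᵘ (p U.+ q) ≡ fromℚᵘ p + fromℚᵘ q
  fromℚᵘ-homo-+ p q = toℚᵘ-injective (UP.≃-trans (toℚᵘ-fromℚᵘ (p U.+ q))
    (UP.≃-sym (UP.≃-trans (toℚᵘ-homo-+ (fromℚᵘ p) (fromℚᵘ q))
       (UP.+-cong (toℚᵘ-fromℚᵘ p) (toℚᵘ-fromℚᵘ q)))))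

  fromℚᵘ-homo-* : ∀ p q → fromℚᵘ (p U.* q) ≡ fromℚᵘ p * fromℚᵘ q
  fromℚᵘ-homo-* p q = toℚᵘ-injective (UP.≃-trans (toℚᵘ-fromℚᵘ (p U.* q))
    (UP.≃-sym (UP.≃-trans (toℚᵘ-homo-* (fromℚᵘ p) (fromℚᵘ q))
       (UP.*-cong (toℚᵘ-fromℚᵘ p) (toℚᵘ-fromℚᵘ q)))))

  fromℚᵘ-homo-neg : ∀ p → fromℚᵘ (U.- p) ≡ - fromℚᵘ p
  fromℚᵘ-homo-neg p = toℚᵘ-injective (UP.≃-trans (toℚᵘ-fromℚᵘ (U.- p))
    (UP.≃-sym (UP.≃-trans (toℚᵘ-homo‿- (fromℚᵘ p)) (UP.-‿cong (toℚᵘ-fromℚᵘ p)))))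

  /-cross : ∀ a b c d → a ℤ.* + suc d ≡ c ℤ.* + suc b → a / suc b ≡ c / suc d
  /-cross a b c d e = fromℚᵘ-cong {mkℚᵘ a b} {mkℚᵘ c d} (U.*≡* e)

ℤ→ℚ : ℤ → ℚ
ℤ→ℚ i = i / 1

ℤ→ℚ-+ : ∀ i j → ℤ→ℚ (i ℤ.+ j) ≡ ℤ→ℚ i + ℤ→ℚ j
ℤ→ℚ-+ i j = trans (/-cross (i ℤ.+ j) 0 (i ℤ.* + 1 ℤ.+ j ℤ.* + 1) 0 unit-factors)
                  (fromℚᵘ-homo-+ (mkℚᵘ i 0) (mkℚᵘ j 0))
  where
  unit-factors : (i ℤ.+ j) ℤ.* + 1 ≡ (i ℤ.* + 1 ℤ.+ j ℤ.* + 1) ℤ.* + 1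
  unit-factors = cong (ℤ._* + 1) (sym (cong₂ ℤ._+_ (ℤP.*-identityʳ i) (ℤP.*-identityʳ j)))

ℤ→ℚ-* : ∀ i j → ℤ→ℚ (i ℤ.* j) ≡ ℤ→ℚ i * ℤ→ℚ j
ℤ→ℚ-* i j = fromℚᵘ-homo-* (mkℚᵘ i 0) (mkℚᵘ j 0)

ℤ→ℚ-- : ∀ i j → ℤ→ℚ (i ℤ.- j) ≡ ℤ→ℚ i + - ℤ→ℚ j
ℤ→ℚ-- i j = trans (ℤ→ℚ-+ i (ℤ.- j)) (cong (λ z → ℤ→ℚ i + z) (fromℚᵘ-homo-neg (mkℚᵘ j 0)))

ℕ→ℚ-+ : ∀ a b → ℕ→ℚ (a +ℕ b) ≡ ℕ→ℚ a + ℕ→ℚ b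
ℕ→ℚ-+ a b = ℤ→ℚ-+ (+ a) (+ b)

ℕ→ℚ-* : ∀ a b → ℕ→ℚ (a *ℕ b) ≡ ℕ→ℚ a * ℕ→ℚ b
ℕ→ℚ-* a b = trans (cong ℤ→ℚ (ℤP.pos-* a b)) (ℤ→ℚ-* (+ a) (+ b))

-- 1/d for a natural d, and 0 for d = 0 (the convention of _÷ℕ_)
recip : ℕ → ℚ
recip d = (+ 1) ÷ℕ d

recip-* : ∀ a b → recip (a *ℕ b) ≡ recip a * recip b
recip-* zero    b       = sym (*-zeroˡ (recip b))
recip-* (suc a) zero    = trans (cong recip (ℕP.*-zeroʳ (suc a))) (sym (*-zeroʳ (recip (suc a))))
recip-* (suc a) (suc b) = fromℚᵘ-homo-* (mkℚᵘ (+ 1) a) (mkℚᵘ (+ 1) b)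

recip-inverse : ∀ x .{{_ : NonZero x}} → recip x * ℕ→ℚ x ≡ 1ℚ
recip-inverse (suc a) = trans (sym (fromℚᵘ-homo-* (mkℚᵘ (+ 1) a) (mkℚᵘ (+ suc a) 0)))
                              (/-cross (+ 1 ℤ.* + suc a) (a *ℕ 1) (+ 1) 0 cross)
  where
  cross : (+ 1 ℤ.* + suc a) ℤ.* + 1 ≡ + 1 ℤ.* + suc (a *ℕ 1)
  cross = trans (ℤP.*-identityʳ _) (trans (ℤP.*-identityˡ _)
            (trans (cong (λ x → + suc x) (sym (ℕP.*-identityʳ a))) (sym (ℤP.*-identityˡ _))))

recip-fact-inverse : ∀ n → recip (n !) * ℕ→ℚ (n !) ≡ 1ℚ
recip-fact-inverse n = recip-inverse (n !) {{ℕP._!≢0 n}}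

÷ℕ-as-recip : ∀ a d → (+ a) ÷ℕ d ≡ ℕ→ℚ a * recip d
÷ℕ-as-recip a zero    = sym (*-zeroʳ (ℕ→ℚ a))
÷ℕ-as-recip a (suc d) = trans (/-cross (+ a) d (+ a ℤ.* + 1) (d +ℕ 0) cross)
                              (fromℚᵘ-homo-* (mkℚᵘ (+ a) 0) (mkℚᵘ (+ 1) d))
  where
  cross : + a ℤ.* + suc (d +ℕ 0) ≡ (+ a ℤ.* + 1) ℤ.* + suc d
  cross = trans (cong (λ x → + a ℤ.* + suc x) (ℕP.+-identityʳ d))
                (cong (ℤ._* + suc d) (sym (ℤP.*-identityʳ (+ a))))

ℕ→ℚ-*-cancelˡ : ∀ x .{{_ : NonZero x}} {u v} → ℕ→ℚ x * u ≡ ℕ→ℚ x * v → u ≡ v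
ℕ→ℚ-*-cancelˡ x {u} {v} e = begin
  u                             ≡⟨ sym (*-identityˡ u) ⟩
  1ℚ * u                        ≡⟨ cong (_* u) (sym (recip-inverse x)) ⟩
  (recip x * ℕ→ℚ x) * u         ≡⟨ *-assoc (recip x) (ℕ→ℚ x) u ⟩
  recip x * (ℕ→ℚ x * u)         ≡⟨ cong (recip x *_) e ⟩
  recip x * (ℕ→ℚ x * v)         ≡⟨ sym (*-assoc (recip x) (ℕ→ℚ x) v) ⟩
  (recip x * ℕ→ℚ x) * v         ≡⟨ cong (_* v) (recip-inverse x) ⟩
  1ℚ * v                        ≡⟨ *-identityˡ v ⟩
  v                             ∎
  where open ≡-Reasoning

sgn-+ : ∀ x y → sgn (x +ℕ y) ≡ sgn x * sgn y
sgn-+ zero    y = sym (*-identityˡ (sgn y))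
sgn-+ (suc x) y = trans (cong (- 1ℚ *_) (sgn-+ x y)) (sym (*-assoc (- 1ℚ) (sgn x) (sgn y)))

sgn-square : ∀ x → sgn x * sgn x ≡ 1ℚ
sgn-square zero    = refl
sgn-square (suc x) =
  trans (solve 2 (λ m s → (m :* s) :* (m :* s) := (m :* m) :* (s :* s)) refl (- 1ℚ) (sgn x))
        (cong ((- 1ℚ * - 1ℚ) *_) (sgn-square x))

Σ< : ℕ → (ℕ → ℚ) → ℚ
Σ< zero    f = 0ℚ
Σ< (suc n) f = f 0 + Σ< n (λ i → f (suc i))

Σ<-cong : ∀ n {f g : ℕ → ℚ} → (∀ i → f i ≡ g i) → Σ< n f ≡ Σ< n g
Σ<-cong zero    e = refl
Σ<-cong (suc n) e = cong₂ _+_ (e 0) (Σ<-cong n (λ i → e (suc i)))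

Σ<-cong< : ∀ n {f g : ℕ → ℚ} → (∀ i → i < n → f i ≡ g i) → Σ< n f ≡ Σ< n g
Σ<-cong< zero    e = refl
Σ<-cong< (suc n) e = cong₂ _+_ (e 0 (s≤s z≤n)) (Σ<-cong< n (λ i i<n → e (suc i) (s≤s i<n)))

Σ<-vanish : ∀ n f → (∀ i → i < n → f i ≡ 0ℚ) → Σ< n f ≡ 0ℚ
Σ<-vanish zero    f e = refl
Σ<-vanish (suc n) f e =
  trans (cong₂ _+_ (e 0 (s≤s z≤n)) (Σ<-vanish n (λ i → f (suc i)) (λ i i<n → e (suc i) (s≤s i<n))))
        (+-identityˡ 0ℚ)

Σ<-snoc : ∀ n f → Σ< (suc n) f ≡ Σ< n f + f n
Σ<-snoc zero    f = trans (+-identityʳ (f 0)) (sym (+-identityˡ (f 0)))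
Σ<-snoc (suc n) f = trans (cong (λ s → f 0 + s) (Σ<-snoc n (λ i → f (suc i))))
                          (sym (+-assoc (f 0) _ _))

Σ<-+ : ∀ n f g → Σ< n (λ i → f i + g i) ≡ Σ< n f + Σ< n g
Σ<-+ zero    f g = refl
Σ<-+ (suc n) f g = trans (cong (λ s → (f 0 + g 0) + s) (Σ<-+ n (λ i → f (suc i)) (λ i → g (suc i))))
  (solve 4 (λ a b c d → (a :+ b) :+ (c :+ d) := (a :+ c) :+ (b :+ d)) refl (f 0) (g 0) _ _)

Σ<-*ˡ : ∀ n c f → c * Σ< n f ≡ Σ< n (λ i → c * f i)
Σ<-*ˡ zero    c f = *-zeroʳ c
Σ<-*ˡ (suc n) c f = trans (*-distribˡ-+ c _ _) (cong (λ s → c * f 0 + s) (Σ<-*ˡ n c _))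

Σ<-*ʳ : ∀ n c f → Σ< n f * c ≡ Σ< n (λ i → f i * c)
Σ<-*ʳ n c f = trans (*-comm _ c) (trans (Σ<-*ˡ n c f) (Σ<-cong n (λ i → *-comm c (f i))))

Σ<-neg : ∀ n f → - Σ< n f ≡ Σ< n (λ i → - f i)
Σ<-neg zero    f = refl
Σ<-neg (suc n) f = trans (neg-distrib-+ (f 0) _) (cong (λ s → - f 0 + s) (Σ<-neg n _))

Σ<-split : ∀ m n f → Σ< (m +ℕ n) f ≡ Σ< m f + Σ< n (λ i → f (m +ℕ i))
Σ<-split zero    n f = sym (+-identityˡ _)
Σ<-split (suc m) n f = trans (cong (λ s → f 0 + s) (Σ<-split m n (λ i → f (suc i))))
                             (sym (+-assoc (f 0) (Σ< m (λ i → f (suc i))) _))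

Σ<-reverse : ∀ n f → Σ< n f ≡ Σ< n (λ i → f (n ∸ suc i))
Σ<-reverse zero    f = refl
Σ<-reverse (suc n) f = begin
  f 0 + Σ< n (λ i → f (suc i))                ≡⟨ +-comm (f 0) _ ⟩
  Σ< n (λ i → f (suc i)) + f 0                ≡⟨ cong (_+ f 0) (Σ<-reverse n (λ i → f (suc i))) ⟩
  Σ< n (λ i → f (suc (n ∸ suc i))) + f 0
    ≡⟨ cong₂ _+_ (Σ<-cong< n (λ i i<n → cong f (sym (ℕP.+-∸-assoc 1 i<n))))
                 (cong f (sym (ℕP.n∸n≡0 n))) ⟩
  Σ< n (λ i → f (suc n ∸ suc i)) + f (n ∸ n)  ≡⟨ sym (Σ<-snoc n (λ i → f (suc n ∸ suc i))) ⟩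
  Σ< (suc n) (λ i → f (suc n ∸ suc i))        ∎
  where open ≡-Reasoning

Σ<-triangle : ∀ n (f : ℕ → ℕ → ℚ) →
  Σ< n (λ i → Σ< (suc i) (f i)) ≡ Σ< n (λ j → Σ< (n ∸ j) (λ k → f (j +ℕ k) j))
Σ<-triangle zero    f = refl
Σ<-triangle (suc n) f = begin
  Σ< (suc n) (λ i → Σ< (suc i) (f i))
    ≡⟨ Σ<-snoc n _ ⟩
  Σ< n (λ i → Σ< (suc i) (f i)) + Σ< (suc n) (f n)
    ≡⟨ cong₂ _+_ (Σ<-triangle n f)
                 (Σ<-cong< (suc n) (λ j j<sn → sym (cong (λ x → f x j) (ℕP.m+[n∸m]≡n (ℕP.≤-pred j<sn))))) ⟩
  Σ< n (λ j → Σ< (n ∸ j) (g j)) + Σ< (suc n) (λ j → g j (n ∸ j))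
    ≡⟨ cong (_+ Σ< (suc n) (λ j → g j (n ∸ j))) (trans (sym (+-identityʳ (Σ< n (λ j → Σ< (n ∸ j) (g j)))))
         (trans (cong (λ z → Σ< n (λ j → Σ< (n ∸ j) (g j)) + Σ< z (g n)) (sym (ℕP.n∸n≡0 n)))
                (sym (Σ<-snoc n (λ j → Σ< (n ∸ j) (g j)))))) ⟩
  Σ< (suc n) (λ j → Σ< (n ∸ j) (g j)) + Σ< (suc n) (λ j → g j (n ∸ j))
    ≡⟨ sym (Σ<-+ (suc n) (λ j → Σ< (n ∸ j) (g j)) (λ j → g j (n ∸ j))) ⟩
  Σ< (suc n) (λ j → Σ< (n ∸ j) (g j) + g j (n ∸ j))
    ≡⟨ Σ<-cong< (suc n) (λ j j<sn → trans (sym (Σ<-snoc (n ∸ j) (g j)))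
         (cong (λ x → Σ< x (g j)) (sym (ℕP.+-∸-assoc 1 (ℕP.≤-pred j<sn))))) ⟩
  Σ< (suc n) (λ j → Σ< (suc n ∸ j) (g j)) ∎
  where
  open ≡-Reasoning
  g : ℕ → ℕ → ℚ
  g j k = f (j +ℕ k) j

sum-cong : ∀ {A : Set} {F G : A → ℚ} xs → (∀ x → F x ≡ G x) → sumℚ (map F xs) ≡ sumℚ (map G xs)
sum-cong []       e = refl
sum-cong (x ∷ xs) e = cong₂ _+_ (e x) (sum-cong xs e)

sum-*ˡ : ∀ {A : Set} c (F : A → ℚ) xs → c * sumℚ (map F xs) ≡ sumℚ (map (λ x → c * F x) xs)
sum-*ˡ c F []       = *-zeroʳ c
sum-*ˡ c F (x ∷ xs) = trans (*-distribˡ-+ c (F x) _) (cong (λ s → c * F x + s) (sum-*ˡ c F xs))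

sum-*ʳ : ∀ {A : Set} c (F : A → ℚ) xs → sumℚ (map F xs) * c ≡ sumℚ (map (λ x → F x * c) xs)
sum-*ʳ c F xs = trans (*-comm _ c) (trans (sum-*ˡ c F xs) (sum-cong xs (λ x → *-comm c (F x))))

sum-++ : ∀ {A : Set} (F : A → ℚ) xs ys →
  sumℚ (map F (xs ++ ys)) ≡ sumℚ (map F xs) + sumℚ (map F ys)
sum-++ F []       ys = sym (+-identityˡ _)
sum-++ F (x ∷ xs) ys = trans (cong (λ s → F x + s) (sum-++ F xs ys)) (sym (+-assoc (F x) _ _))

sum-concatMap : ∀ {A B : Set} (F : B → ℚ) (g : A → List B) xs →
  sumℚ (map F (concatMap g xs)) ≡ sumℚ (map (λ x → sumℚ (map F (g x))) xs)
sum-concatMap F g []       = refl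
sum-concatMap F g (x ∷ xs) =
  trans (sum-++ F (g x) (concatMap g xs)) (cong (λ s → sumℚ (map F (g x)) + s) (sum-concatMap F g xs))

sum-map-map : ∀ {A B : Set} (F : B → ℚ) (h : A → B) xs →
  sumℚ (map F (map h xs)) ≡ sumℚ (map (F ∘ h) xs)
sum-map-map F h []       = refl
sum-map-map F h (x ∷ xs) = cong (λ s → F (h x) + s) (sum-map-map F h xs)

sum-applyUpTo : ∀ n (w : ℕ → ℚ) → sumℚ (applyUpTo w n) ≡ Σ< n w
sum-applyUpTo zero    w = refl
sum-applyUpTo (suc n) w = cong (λ s → w 0 + s) (sum-applyUpTo n (w ∘ suc))

sum-upTo : ∀ n (w : ℕ → ℚ) → sumℚ (map w (upTo n)) ≡ Σ< n w
sum-upTo n w = trans (cong sumℚ (map-upTo w n)) (sum-applyUpTo n w)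

Σ-range : ∀ a b f → Σ[ a ⋯ b ] f ≡ Σ< (suc b ∸ a) (λ i → f (a +ℕ i))
Σ-range a b f = trans (cong (λ xs → sumℚ (map f xs)) (map-upTo (a +ℕ_) (suc b ∸ a)))
  (trans (cong sumℚ (map-applyUpTo (a +ℕ_) f (suc b ∸ a))) (sum-applyUpTo (suc b ∸ a) (f ∘ (a +ℕ_))))

private
  <∸⇒+< : ∀ a n i → i < n ∸ a → a +ℕ i < n
  <∸⇒+< zero    n       i i<n   = i<n
  <∸⇒+< (suc a) (suc n) i i<n∸a = s≤s (<∸⇒+< a n i i<n∸a)

Σ-range-cong : ∀ a b {f g : ℕ → ℚ} → (∀ x → a ≤ x → x ≤ b → f x ≡ g x) → Σ[ a ⋯ b ] f ≡ Σ[ a ⋯ b ] g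
Σ-range-cong a b {f} {g} e = trans (Σ-range a b f) (trans
  (Σ<-cong< (suc b ∸ a) (λ i i< → e (a +ℕ i) (ℕP.m≤m+n a i) (ℕP.≤-pred (<∸⇒+< a (suc b) i i<))))
  (sym (Σ-range a b g)))

Σ-range-*ˡ : ∀ a b c (f : ℕ → ℚ) → c * Σ[ a ⋯ b ] f ≡ Σ[ a ⋯ b ] (λ i → c * f i)
Σ-range-*ˡ a b c f = trans (cong (c *_) (Σ-range a b f))
  (trans (Σ<-*ˡ (suc b ∸ a) c (λ i → f (a +ℕ i))) (sym (Σ-range a b (λ i → c * f i))))

Σ-range-from : ∀ c b (f : ℕ → ℚ) → c ≤ suc b → (∀ x → x < c → f x ≡ 0ℚ) → Σ[ 0 ⋯ b ] f ≡ Σ[ c ⋯ b ] f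
Σ-range-from c b f c≤ f≡0 = begin
  Σ[ 0 ⋯ b ] f                                              ≡⟨ Σ-range 0 b f ⟩
  Σ< (suc b) f                                              ≡⟨ cong (λ z → Σ< z f) (sym (ℕP.m+[n∸m]≡n c≤)) ⟩
  Σ< (c +ℕ (suc b ∸ c)) f                                   ≡⟨ Σ<-split c (suc b ∸ c) f ⟩
  Σ< c f + Σ< (suc b ∸ c) (λ i → f (c +ℕ i))
    ≡⟨ cong (_+ Σ< (suc b ∸ c) (λ i → f (c +ℕ i))) (Σ<-vanish c f f≡0) ⟩
  0ℚ + Σ< (suc b ∸ c) (λ i → f (c +ℕ i))                    ≡⟨ trans (+-identityˡ _) (sym (Σ-range c b f)) ⟩
  Σ[ c ⋯ b ] f                                              ∎
  where open ≡-Reasoning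

Σ-range-reverse : ∀ j n (h : ℕ → ℚ) → j ≤ n → Σ[ j ⋯ n ] h ≡ Σ[ 0 ⋯ n ∸ j ] (λ l → h (n ∸ l))
Σ-range-reverse j n h j≤n = begin
  Σ[ j ⋯ n ] h                                     ≡⟨ Σ-range j n h ⟩
  Σ< (suc n ∸ j) (λ i → h (j +ℕ i))                ≡⟨ cong (λ z → Σ< z (λ i → h (j +ℕ i))) (ℕP.+-∸-assoc 1 j≤n) ⟩
  Σ< (suc (n ∸ j)) (λ i → h (j +ℕ i))              ≡⟨ Σ<-reverse (suc (n ∸ j)) (λ i → h (j +ℕ i)) ⟩
  Σ< (suc (n ∸ j)) (λ i → h (j +ℕ (n ∸ j ∸ i)))
    ≡⟨ Σ<-cong< (suc (n ∸ j)) (λ i i< → cong h (j+[n∸j∸i]≡n∸i i (ℕP.≤-pred i<))) ⟩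
  Σ< (suc (n ∸ j)) (λ i → h (n ∸ i))               ≡⟨ sym (Σ-range 0 (n ∸ j) (λ l → h (n ∸ l))) ⟩
  Σ[ 0 ⋯ n ∸ j ] (λ l → h (n ∸ l))                 ∎
  where
  open ≡-Reasoning
  j+[n∸j∸i]≡n∸i : ∀ i → i ≤ n ∸ j → j +ℕ (n ∸ j ∸ i) ≡ n ∸ i
  j+[n∸j∸i]≡n∸i i i≤ = begin
    j +ℕ (n ∸ j ∸ i)      ≡⟨ cong (j +ℕ_) (ℕP.∸-+-assoc n j i) ⟩
    j +ℕ (n ∸ (j +ℕ i))   ≡⟨ sym (ℕP.+-∸-assoc j (ℕP.≤-trans (ℕP.+-monoʳ-≤ j i≤) (ℕP.≤-reflexive (ℕP.m+[n∸m]≡n j≤n)))) ⟩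
    j +ℕ n ∸ (j +ℕ i)     ≡⟨ ℕP.[m+n]∸[m+o]≡n∸o j n i ⟩
    n ∸ i                 ∎

Σ-range-triangle : ∀ j′ n′ (G : ℕ → ℕ → ℚ) →
  Σ[ suc j′ ⋯ suc n′ ] (λ a → Σ[ j′ ⋯ a ∸ 1 ] (G a))
    ≡ Σ[ suc j′ ⋯ suc n′ ] (λ m → Σ[ m ⋯ suc n′ ] (λ a → G a (m ∸ 1)))
Σ-range-triangle j′ n′ G = begin
  Σ[ suc j′ ⋯ suc n′ ] (λ a → Σ[ j′ ⋯ a ∸ 1 ] (G a))
    ≡⟨ Σ-range (suc j′) (suc n′) _ ⟩
  Σ< c (λ i → Σ[ j′ ⋯ j′ +ℕ i ] (G (suc (j′ +ℕ i))))
    ≡⟨ Σ<-cong c (λ i → trans (Σ-range j′ (j′ +ℕ i) (G (suc (j′ +ℕ i))))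
         (cong (λ z → Σ< z (λ t → G (suc (j′ +ℕ i)) (j′ +ℕ t)))
               (trans (cong (_∸ j′) (sym (ℕP.+-suc j′ i))) (ℕP.m+n∸m≡n j′ (suc i))))) ⟩
  Σ< c (λ i → Σ< (suc i) (λ t → G (suc (j′ +ℕ i)) (j′ +ℕ t)))
    ≡⟨ Σ<-triangle c (λ i t → G (suc (j′ +ℕ i)) (j′ +ℕ t)) ⟩
  Σ< c (λ t → Σ< (c ∸ t) (λ s → G (suc (j′ +ℕ (t +ℕ s))) (j′ +ℕ t)))
    ≡⟨ Σ<-cong c (λ t → sym (trans (Σ-range (suc (j′ +ℕ t)) (suc n′) (λ a → G a (j′ +ℕ t)))
         (trans (cong (λ z → Σ< z (λ s → G (suc (j′ +ℕ t) +ℕ s) (j′ +ℕ t))) (sym (ℕP.∸-+-assoc (suc n′) j′ t)))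
                (Σ<-cong (c ∸ t) (λ s → cong (λ z → G (suc z) (j′ +ℕ t)) (ℕP.+-assoc j′ t s)))))) ⟩
  Σ< c (λ t → Σ[ suc (j′ +ℕ t) ⋯ suc n′ ] (λ a → G a (j′ +ℕ t)))
    ≡⟨ sym (Σ-range (suc j′) (suc n′) _) ⟩
  Σ[ suc j′ ⋯ suc n′ ] (λ m → Σ[ m ⋯ suc n′ ] (λ a → G a (m ∸ 1))) ∎
  where
  open ≡-Reasoning
  c : ℕ
  c = suc n′ ∸ j′

infixl 6 _⊕_
_⊕_ : PS → PS → PS
(f ⊕ g) i = f i + g i

infixr 7 _·_
_·_ : ℚ → PS → PS
(c · f) i = c * f i

negPS : PS → PS
negPS f i = - f i

shift : PS → PS
shift f zero    = 0ℚ
shift f (suc i) = f i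

θ : PS → PS
θ f i = ℕ→ℚ i * f i

zeroPS : PS
zeroPS _ = 0ℚ

⊛-def : ∀ f g n → (f ⊛ g) n ≡ Σ< (suc n) (λ i → f i * g (n ∸ i))
⊛-def f g n = Σ-range 0 n (λ i → f i * g (n ∸ i))

⊛-cong : ∀ {f f′ g g′} → f ≗ f′ → g ≗ g′ → (f ⊛ g) ≗ (f′ ⊛ g′)
⊛-cong {f} {f′} {g} {g′} e₁ e₂ n = trans (⊛-def f g n)
  (trans (Σ<-cong (suc n) (λ i → cong₂ _*_ (e₁ i) (e₂ (n ∸ i)))) (sym (⊛-def f′ g′ n)))

⊛-congʳ : ∀ f {g g′} → g ≗ g′ → (f ⊛ g) ≗ (f ⊛ g′)
⊛-congʳ f = ⊛-cong {f} {f} (λ _ → refl)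

⊛-comm : ∀ f g → (f ⊛ g) ≗ (g ⊛ f)
⊛-comm f g n = trans (⊛-def f g n) (trans (Σ<-reverse (suc n) (λ i → f i * g (n ∸ i)))
  (trans (Σ<-cong< (suc n) (λ i i<sn → trans (cong (λ x → f (n ∸ i) * g x) (ℕP.m∸[m∸n]≡n (ℕP.≤-pred i<sn)))
                                             (*-comm (f (n ∸ i)) (g i))))
         (sym (⊛-def g f n))))

⊛-assoc : ∀ f g h → ((f ⊛ g) ⊛ h) ≗ (f ⊛ (g ⊛ h))
⊛-assoc f g h n = begin
  ((f ⊛ g) ⊛ h) n
    ≡⟨ ⊛-def (f ⊛ g) h n ⟩
  Σ< (suc n) (λ i → (f ⊛ g) i * h (n ∸ i))
    ≡⟨ Σ<-cong (suc n) (λ i → trans (cong (_* h (n ∸ i)) (⊛-def f g i))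
                                     (Σ<-*ʳ (suc i) (h (n ∸ i)) (λ j → f j * g (i ∸ j)))) ⟩
  Σ< (suc n) (λ i → Σ< (suc i) (λ j → f j * g (i ∸ j) * h (n ∸ i)))
    ≡⟨ Σ<-triangle (suc n) (λ i j → f j * g (i ∸ j) * h (n ∸ i)) ⟩
  Σ< (suc n) (λ j → Σ< (suc n ∸ j) (λ k → f j * g (j +ℕ k ∸ j) * h (n ∸ (j +ℕ k))))
    ≡⟨ Σ<-cong< (suc n) (λ j j<sn → inner j (ℕP.≤-pred j<sn)) ⟩
  Σ< (suc n) (λ j → f j * (g ⊛ h) (n ∸ j))
    ≡⟨ sym (⊛-def f (g ⊛ h) n) ⟩
  (f ⊛ (g ⊛ h)) n ∎
  where
  open ≡-Reasoning
  inner : ∀ j → j ≤ n →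
    Σ< (suc n ∸ j) (λ k → f j * g (j +ℕ k ∸ j) * h (n ∸ (j +ℕ k))) ≡ f j * (g ⊛ h) (n ∸ j)
  inner j j≤n = begin
    Σ< (suc n ∸ j) (λ k → f j * g (j +ℕ k ∸ j) * h (n ∸ (j +ℕ k)))
      ≡⟨ cong (λ x → Σ< x (λ k → f j * g (j +ℕ k ∸ j) * h (n ∸ (j +ℕ k)))) (ℕP.+-∸-assoc 1 j≤n) ⟩
    Σ< (suc (n ∸ j)) (λ k → f j * g (j +ℕ k ∸ j) * h (n ∸ (j +ℕ k)))
      ≡⟨ Σ<-cong (suc (n ∸ j)) (λ k → trans
           (cong₂ (λ x y → f j * g x * h y) (ℕP.m+n∸m≡n j k) (sym (ℕP.∸-+-assoc n j k)))
           (*-assoc (f j) (g k) (h (n ∸ j ∸ k)))) ⟩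
    Σ< (suc (n ∸ j)) (λ k → f j * (g k * h (n ∸ j ∸ k)))
      ≡⟨ sym (Σ<-*ˡ (suc (n ∸ j)) (f j) (λ k → g k * h (n ∸ j ∸ k))) ⟩
    f j * Σ< (suc (n ∸ j)) (λ k → g k * h (n ∸ j ∸ k))
      ≡⟨ cong (f j *_) (sym (⊛-def g h (n ∸ j))) ⟩
    f j * (g ⊛ h) (n ∸ j) ∎

⊛-identityˡ : ∀ g → (onePS ⊛ g) ≗ g
⊛-identityˡ g n = trans (⊛-def onePS g n) (trans
  (cong₂ _+_ (*-identityˡ (g n)) (Σ<-vanish n (λ i → 0ℚ * g (n ∸ suc i)) (λ i _ → *-zeroˡ (g (n ∸ suc i)))))
  (+-identityʳ (g n)))

⊛-identityʳ : ∀ g → (g ⊛ onePS) ≗ g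
⊛-identityʳ g n = trans (⊛-comm g onePS n) (⊛-identityˡ g n)

⊛-zeroʳ : ∀ f → (f ⊛ zeroPS) ≗ zeroPS
⊛-zeroʳ f n = trans (⊛-def f zeroPS n) (Σ<-vanish (suc n) (λ i → f i * 0ℚ) (λ i _ → *-zeroʳ (f i)))

⊛-distribˡ-⊕ : ∀ f g h → (f ⊛ (g ⊕ h)) ≗ ((f ⊛ g) ⊕ (f ⊛ h))
⊛-distribˡ-⊕ f g h n = trans (⊛-def f (g ⊕ h) n)
  (trans (Σ<-cong (suc n) (λ i → *-distribˡ-+ (f i) (g (n ∸ i)) (h (n ∸ i))))
  (trans (Σ<-+ (suc n) (λ i → f i * g (n ∸ i)) (λ i → f i * h (n ∸ i)))
         (sym (cong₂ _+_ (⊛-def f g n) (⊛-def f h n)))))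

⊛-distribʳ-⊕ : ∀ f g h → ((g ⊕ h) ⊛ f) ≗ ((g ⊛ f) ⊕ (h ⊛ f))
⊛-distribʳ-⊕ f g h n = trans (⊛-comm (g ⊕ h) f n)
  (trans (⊛-distribˡ-⊕ f g h n) (cong₂ _+_ (⊛-comm f g n) (⊛-comm f h n)))

⊛-·ʳ : ∀ f c g → (f ⊛ (c · g)) ≗ (c · (f ⊛ g))
⊛-·ʳ f c g n = trans (⊛-def f (c · g) n)
  (trans (Σ<-cong (suc n) (λ i → solve 3 (λ a c b → a :* (c :* b) := c :* (a :* b)) refl (f i) c (g (n ∸ i))))
  (trans (sym (Σ<-*ˡ (suc n) c (λ i → f i * g (n ∸ i)))) (cong (c *_) (sym (⊛-def f g n)))))

⊛-negʳ : ∀ f g → (f ⊛ negPS g) ≗ negPS (f ⊛ g)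
⊛-negʳ f g n = trans (⊛-def f (negPS g) n)
  (trans (Σ<-cong (suc n) (λ i → sym (neg-distribʳ-* (f i) (g (n ∸ i)))))
  (trans (sym (Σ<-neg (suc n) (λ i → f i * g (n ∸ i)))) (cong -_ (sym (⊛-def f g n)))))

⊛-negˡ : ∀ f g → (negPS g ⊛ f) ≗ negPS (g ⊛ f)
⊛-negˡ f g n = trans (⊛-comm (negPS g) f n) (trans (⊛-negʳ f g n) (cong -_ (⊛-comm f g n)))

shift-cong : ∀ {f g} → f ≗ g → shift f ≗ shift g
shift-cong e zero    = refl
shift-cong e (suc n) = e n

⊛-shiftˡ : ∀ f g → (shift f ⊛ g) ≗ shift (f ⊛ g)
⊛-shiftˡ f g zero    = trans (⊛-def (shift f) g 0) (trans (+-identityʳ (0ℚ * g 0)) (*-zeroˡ (g 0)))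
⊛-shiftˡ f g (suc n) = trans (⊛-def (shift f) g (suc n))
  (trans (cong (_+ Σ< (suc n) (λ i → f i * g (n ∸ i))) (*-zeroˡ (g (suc n))))
  (trans (+-identityˡ _) (sym (⊛-def f g n))))

⊛-shiftʳ : ∀ f g → (f ⊛ shift g) ≗ shift (f ⊛ g)
⊛-shiftʳ f g n = trans (⊛-comm f (shift g) n) (trans (⊛-shiftˡ g f n) (shift-cong (⊛-comm g f) n))

θ-⊛ : ∀ f g → θ (f ⊛ g) ≗ ((θ f ⊛ g) ⊕ (f ⊛ θ g))
θ-⊛ f g n = begin
  ℕ→ℚ n * (f ⊛ g) n
    ≡⟨ cong (ℕ→ℚ n *_) (⊛-def f g n) ⟩
  ℕ→ℚ n * Σ< (suc n) (λ i → f i * g (n ∸ i))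
    ≡⟨ Σ<-*ˡ (suc n) (ℕ→ℚ n) (λ i → f i * g (n ∸ i)) ⟩
  Σ< (suc n) (λ i → ℕ→ℚ n * (f i * g (n ∸ i)))
    ≡⟨ Σ<-cong< (suc n) (λ i i<sn → leibniz i (ℕP.≤-pred i<sn)) ⟩
  Σ< (suc n) (λ i → θ f i * g (n ∸ i) + f i * θ g (n ∸ i))
    ≡⟨ Σ<-+ (suc n) (λ i → θ f i * g (n ∸ i)) (λ i → f i * θ g (n ∸ i)) ⟩
  Σ< (suc n) (λ i → θ f i * g (n ∸ i)) + Σ< (suc n) (λ i → f i * θ g (n ∸ i))
    ≡⟨ sym (cong₂ _+_ (⊛-def (θ f) g n) (⊛-def f (θ g) n)) ⟩
  ((θ f ⊛ g) ⊕ (f ⊛ θ g)) n ∎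
  where
  open ≡-Reasoning
  -- n = i + (n - i)
  leibniz : ∀ i → i ≤ n → ℕ→ℚ n * (f i * g (n ∸ i)) ≡ θ f i * g (n ∸ i) + f i * θ g (n ∸ i)
  leibniz i i≤n = trans (cong (λ x → ℕ→ℚ x * (f i * g (n ∸ i))) (sym (ℕP.m+[n∸m]≡n i≤n)))
    (trans (cong (_* (f i * g (n ∸ i))) (ℕ→ℚ-+ i (n ∸ i)))
           (solve 4 (λ x y a b → (x :+ y) :* (a :* b) := (x :* a) :* b :+ a :* (y :* b)) refl
                    (ℕ→ℚ i) (ℕ→ℚ (n ∸ i)) (f i) (g (n ∸ i))))

θ-one : θ onePS ≗ zeroPS
θ-one zero    = *-zeroˡ 1ℚ
θ-one (suc n) = *-zeroʳ (ℕ→ℚ (suc n))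

θ-pow : ∀ f a → θ (f ^PS suc a) ≗ (ℕ→ℚ (suc a) · ((f ^PS a) ⊛ θ f))
θ-pow f zero n = begin
  θ (f ⊛ onePS) n                    ≡⟨ θ-⊛ f onePS n ⟩
  (θ f ⊛ onePS) n + (f ⊛ θ onePS) n  ≡⟨ cong₂ _+_ (⊛-identityʳ (θ f) n) (trans (⊛-congʳ f θ-one n) (⊛-zeroʳ f n)) ⟩
  θ f n + 0ℚ                         ≡⟨ +-identityʳ (θ f n) ⟩
  θ f n                              ≡⟨ sym (trans (*-identityˡ _) (⊛-identityˡ (θ f) n)) ⟩
  1ℚ * (onePS ⊛ θ f) n               ∎
  where open ≡-Reasoning
θ-pow f (suc a) n = begin
  θ (f ⊛ (f ^PS suc a)) n
    ≡⟨ θ-⊛ f (f ^PS suc a) n ⟩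
  (θ f ⊛ (f ^PS suc a)) n + (f ⊛ θ (f ^PS suc a)) n
    ≡⟨ cong₂ _+_ (⊛-comm (θ f) (f ^PS suc a) n)
         (trans (⊛-congʳ f (θ-pow f a) n) (trans (⊛-·ʳ f c ((f ^PS a) ⊛ θ f) n)
                (cong (c *_) (sym (⊛-assoc f (f ^PS a) (θ f) n))))) ⟩
  X + c * X
    ≡⟨ solve 2 (λ X c → X :+ c :* X := (con 1ℚ :+ c) :* X) refl X c ⟩
  (1ℚ + c) * X
    ≡⟨ cong (_* X) (sym (ℕ→ℚ-+ 1 (suc a))) ⟩
  ℕ→ℚ (suc (suc a)) * X ∎
  where
  open ≡-Reasoning
  c : ℚ
  c = ℕ→ℚ (suc a)
  X : ℚ
  X = ((f ^PS suc a) ⊛ θ f) n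

private
  invRev-as-applyUpTo : ∀ f n → invRev f n ≡ applyUpTo (λ i → invPS f (n ∸ i)) (suc n)
  invRev-as-applyUpTo f zero    = refl
  invRev-as-applyUpTo f (suc n) = cong (invPS f (suc n) ∷_) (invRev-as-applyUpTo f n)

  zipWith-applyUpTo : ∀ m (h : ℕ → ℚ → ℚ) (u : ℕ → ℕ) (v : ℕ → ℚ) →
    zipWith h (applyUpTo u m) (applyUpTo v m) ≡ applyUpTo (λ i → h (u i) (v i)) m
  zipWith-applyUpTo zero    h u v = refl
  zipWith-applyUpTo (suc m) h u v = cong (h (u 0) (v 0) ∷_) (zipWith-applyUpTo m h (u ∘ suc) (v ∘ suc))

invPS-recurrence : ∀ f n → invPS f (suc n) ≡ - Σ< (suc n) (λ i → f (suc i) * invPS f (n ∸ i))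
invPS-recurrence f n = cong -_ (begin
  sumℚ (zipWith (λ i g → f (suc i) * g) (upTo (suc n)) (invRev f n))
    ≡⟨ cong (λ gs → sumℚ (zipWith (λ i g → f (suc i) * g) (upTo (suc n)) gs)) (invRev-as-applyUpTo f n) ⟩
  sumℚ (zipWith (λ i g → f (suc i) * g) (upTo (suc n)) (applyUpTo (λ i → invPS f (n ∸ i)) (suc n)))
    ≡⟨ cong sumℚ (zipWith-applyUpTo (suc n) (λ i g → f (suc i) * g) (λ i → i) (λ i → invPS f (n ∸ i))) ⟩
  sumℚ (applyUpTo (λ i → f (suc i) * invPS f (n ∸ i)) (suc n))
    ≡⟨ sum-applyUpTo (suc n) (λ i → f (suc i) * invPS f (n ∸ i)) ⟩
  Σ< (suc n) (λ i → f (suc i) * invPS f (n ∸ i)) ∎)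
  where open ≡-Reasoning

invPS-inverse : ∀ f → f 0 ≡ 1ℚ → (f ⊛ invPS f) ≗ onePS
invPS-inverse f f0≡1 zero    = trans (⊛-def f (invPS f) 0) (trans (+-identityʳ _) (cong (_* 1ℚ) f0≡1))
invPS-inverse f f0≡1 (suc n) = trans (⊛-def f (invPS f) (suc n))
  (trans (cong (_+ Σ< (suc n) (λ i → f (suc i) * invPS f (n ∸ i)))
               (trans (cong (_* invPS f (suc n)) f0≡1) (trans (*-identityˡ _) (invPS-recurrence f n))))
         (+-inverseˡ (Σ< (suc n) (λ i → f (suc i) * invPS f (n ∸ i)))))

E : PS
E = expm1OverT

β : PS
β = bernoulliGF

E⊛β : (E ⊛ β) ≗ onePS
E⊛β = invPS-inverse E refl

β⊛E : (β ⊛ E) ≗ onePS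
β⊛E n = trans (⊛-comm β E n) (E⊛β n)

-- θE + E = e^t = 1 + tE, i.e. (m+1)/(m+2)! + 1/(m+2)! = 1/(m+1)!
θE⊕E : (θ E ⊕ E) ≗ (onePS ⊕ shift E)
θE⊕E zero    = refl
θE⊕E (suc m) = trans (coefficient (suc m !) {{ℕP._!≢0 (suc m)}}) (sym (+-identityˡ (E m)))
  where
  coefficient : ∀ X .{{_ : NonZero X}} →
    ℕ→ℚ (suc m) * recip (suc (suc m) *ℕ X) + recip (suc (suc m) *ℕ X) ≡ recip X
  coefficient X = begin
    c * recip (suc (suc m) *ℕ X) + recip (suc (suc m) *ℕ X)
      ≡⟨ cong (λ x → c * x + x) (recip-* (suc (suc m)) X) ⟩
    c * (p * q) + p * q
      ≡⟨ solve 3 (λ c p q → c :* (p :* q) :+ p :* q := (p :* (con 1ℚ :+ c)) :* q) refl c p q ⟩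
    (p * (1ℚ + c)) * q
      ≡⟨ cong (λ x → (p * x) * q) (trans (sym (ℕ→ℚ-+ 1 (suc m))) (sym (*-identityˡ _))) ⟩
    (p * (1ℚ * ℕ→ℚ (suc (suc m)))) * q
      ≡⟨ cong (_* q) (trans (sym (*-assoc p 1ℚ _)) (trans (cong (_* ℕ→ℚ (suc (suc m))) (*-identityʳ p))
                                                   (recip-inverse (suc (suc m))))) ⟩
    1ℚ * q
      ≡⟨ *-identityˡ q ⟩
    q ∎
    where
    open ≡-Reasoning
    c p q : ℚ
    c = ℕ→ℚ (suc m)
    p = recip (suc (suc m))
    q = recip X

private
  x+y≡0⇒y≡-x : ∀ x y → x + y ≡ 0ℚ → y ≡ - x
  x+y≡0⇒y≡-x x y e = trans (solve 2 (λ x y → y := (x :+ y) :- x) refl x y)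
                            (trans (cong (_+ - x) e) (+-identityˡ (- x)))

  -- differentiating E β = 1 gives E θβ = - θE β
  E⊛θβ : (E ⊛ θ β) ≗ negPS (θ E ⊛ β)
  E⊛θβ n = x+y≡0⇒y≡-x _ _ (trans (sym (θ-⊛ E β n)) (trans (cong (ℕ→ℚ n *_) (E⊛β n)) (θ-one n)))

  -- θE = 1 + tE - E, hence θE β = β + t - 1
  θE⊛β : (θ E ⊛ β) ≗ ((β ⊕ shift onePS) ⊕ negPS onePS)
  θE⊛β n = begin
    (θ E ⊛ β) n
      ≡⟨ ⊛-cong {θ E} {(onePS ⊕ shift E) ⊕ negPS E} {β} (λ i → θE≡ i) (λ _ → refl) n ⟩
    (((onePS ⊕ shift E) ⊕ negPS E) ⊛ β) n
      ≡⟨ ⊛-distribʳ-⊕ β (onePS ⊕ shift E) (negPS E) n ⟩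
    ((onePS ⊕ shift E) ⊛ β) n + (negPS E ⊛ β) n
      ≡⟨ cong₂ _+_ (⊛-distribʳ-⊕ β onePS (shift E) n) (⊛-negˡ β E n) ⟩
    ((onePS ⊛ β) n + (shift E ⊛ β) n) + - (E ⊛ β) n
      ≡⟨ cong₂ _+_ (cong₂ _+_ (⊛-identityˡ β n) (trans (⊛-shiftˡ E β n) (shift-cong E⊛β n)))
                   (cong -_ (E⊛β n)) ⟩
    ((β ⊕ shift onePS) ⊕ negPS onePS) n ∎
    where
    open ≡-Reasoning
    θE≡ : ∀ i → θ E i ≡ (onePS i + shift E i) + - E i
    θE≡ i = trans (solve 2 (λ a b → a := (a :+ b) :- b) refl (θ E i) (E i)) (cong (_+ - E i) (θE⊕E i))

θβ : ∀ n → θ β n ≡ β n + - (β ⊛ β) n + - shift β n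
θβ n = begin
  θ β n
    ≡⟨ sym (⊛-identityˡ (θ β) n) ⟩
  (onePS ⊛ θ β) n
    ≡⟨ ⊛-cong {onePS} {β ⊛ E} {θ β} (λ i → sym (β⊛E i)) (λ _ → refl) n ⟩
  ((β ⊛ E) ⊛ θ β) n
    ≡⟨ ⊛-assoc β E (θ β) n ⟩
  (β ⊛ (E ⊛ θ β)) n
    ≡⟨ trans (⊛-congʳ β E⊛θβ n) (⊛-negʳ β (θ E ⊛ β) n) ⟩
  - (β ⊛ (θ E ⊛ β)) n
    ≡⟨ cong -_ (trans (⊛-congʳ β θE⊛β n) (⊛-distribˡ-⊕ β (β ⊕ shift onePS) (negPS onePS) n)) ⟩
  - ((β ⊛ (β ⊕ shift onePS)) n + (β ⊛ negPS onePS) n)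
    ≡⟨ cong -_ (cong₂ _+_ (trans (⊛-distribˡ-⊕ β β (shift onePS) n)
                               (cong (λ s → (β ⊛ β) n + s) (trans (⊛-shiftʳ β onePS n) (shift-cong (⊛-identityʳ β) n))))
                          (trans (⊛-negʳ β onePS n) (cong -_ (⊛-identityʳ β n)))) ⟩
  - (((β ⊛ β) n + shift β n) + - β n)
    ≡⟨ solve 3 (λ a b c → :- ((a :+ c) :+ :- b) := b :+ :- a :+ :- c) refl ((β ⊛ β) n) (β n) (shift β n) ⟩
  β n + - (β ⊛ β) n + - shift β n ∎
  where open ≡-Reasoning

b : ℕ → ℕ → ℚ
b N k = (β ^PS N) k

b-constant : ∀ N → b N 0 ≡ 1ℚ
b-constant zero    = refl
b-constant (suc N) = trans (⊛-def β (β ^PS N) 0) (trans (+-identityʳ _) (cong (β 0 *_) (b-constant N)))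

-- θ(β^(a+1)) = (a+1) β^a θβ = (a+1)(β^(a+1) - β^(a+2) - t β^(a+1)), coefficientwise
b-recurrence : ∀ a k →
  ℕ→ℚ k * b (suc a) k ≡ ℕ→ℚ (suc a) * (b (suc a) k + - b (suc (suc a)) k + - shift (β ^PS suc a) k)
b-recurrence a k = begin
  θ (β ^PS suc a) k
    ≡⟨ θ-pow β a k ⟩
  c * ((β ^PS a) ⊛ θ β) k
    ≡⟨ cong (c *_) (⊛-congʳ (β ^PS a) θβ k) ⟩
  c * ((β ^PS a) ⊛ ((β ⊕ negPS (β ⊛ β)) ⊕ negPS (shift β))) k
    ≡⟨ cong (c *_) (trans (⊛-distribˡ-⊕ (β ^PS a) (β ⊕ negPS (β ⊛ β)) (negPS (shift β)) k)
         (cong₂ _+_ (trans (⊛-distribˡ-⊕ (β ^PS a) β (negPS (β ⊛ β)) k)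
                           (cong₂ _+_ (⊛-comm (β ^PS a) β k)
                                      (trans (⊛-negʳ (β ^PS a) (β ⊛ β) k) (cong -_ (β^a⊛β² k)))))
                    (trans (⊛-negʳ (β ^PS a) (shift β) k)
                           (cong -_ (trans (⊛-shiftʳ (β ^PS a) β k) (shift-cong (⊛-comm (β ^PS a) β) k)))))) ⟩
  c * (b (suc a) k + - b (suc (suc a)) k + - shift (β ^PS suc a) k) ∎
  where
  open ≡-Reasoning
  c : ℚ
  c = ℕ→ℚ (suc a)
  β^a⊛β² : ((β ^PS a) ⊛ (β ⊛ β)) ≗ (β ^PS suc (suc a))
  β^a⊛β² k = trans (sym (⊛-assoc (β ^PS a) β β k))
    (trans (⊛-comm ((β ^PS a) ⊛ β) β k) (⊛-congʳ β (⊛-comm (β ^PS a) β) k))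

S₁-vanish : ∀ n m → n < m → S₁ n m ≡ + 0
S₁-vanish zero    (suc m) _ = refl
S₁-vanish (suc n) (suc m) (s≤s n<m)
  rewrite S₁-vanish n m n<m | S₁-vanish n (suc m) (ℕP.m<n⇒m<1+n n<m) =
  cong (λ x → + 0 ℤ.- x) (ℤP.*-zeroʳ (+ n))

S₁ℚ-vanish : ∀ n m → n < m → S₁ℚ n m ≡ 0ℚ
S₁ℚ-vanish n m n<m = cong ℤ→ℚ (S₁-vanish n m n<m)

S₁ℚ-recurrence : ∀ n m → S₁ℚ (suc n) (suc m) ≡ S₁ℚ n m + - (ℕ→ℚ n * S₁ℚ n (suc m))
S₁ℚ-recurrence n m = trans (ℤ→ℚ-- (S₁ n m) (+ n ℤ.* S₁ n (suc m)))
                           (cong (λ x → S₁ℚ n m + - x) (ℤ→ℚ-* (+ n) (S₁ n (suc m))))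

ℕ→ℚ-suc-! : ∀ n → ℕ→ℚ (suc n !) ≡ ℕ→ℚ (suc n) * ℕ→ℚ (n !)
ℕ→ℚ-suc-! n = ℕ→ℚ-* (suc n) (n !)

b-step : ∀ a k → ℕ→ℚ (suc a) * b (suc (suc a)) k
                 ≡ (ℕ→ℚ (suc a) + - ℕ→ℚ k) * b (suc a) k + - (ℕ→ℚ (suc a) * shift (β ^PS suc a) k)
b-step a k = begin
  N * y
    ≡⟨ solve 4 (λ N x y z → N :* y := N :* x :+ :- (N :* (x :+ :- y :+ :- z)) :+ :- (N :* z)) refl N x y z ⟩
  N * x + - (N * (x + - y + - z)) + - (N * z)
    ≡⟨ cong (λ w → N * x + - w + - (N * z)) (sym (b-recurrence a k)) ⟩
  N * x + - (ℕ→ℚ k * x) + - (N * z)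
    ≡⟨ solve 4 (λ N K x z → N :* x :+ :- (K :* x) :+ :- (N :* z) := (N :+ :- K) :* x :+ :- (N :* z)) refl N (ℕ→ℚ k) x z ⟩
  (N + - ℕ→ℚ k) * x + - (N * z) ∎
  where
  open ≡-Reasoning
  N x y z : ℚ
  N = ℕ→ℚ (suc a)
  x = b (suc a) k
  y = b (suc (suc a)) k
  z = shift (β ^PS suc a) k

b-diagonal : ∀ a → b (suc (suc a)) (suc a) ≡ - b (suc a) a
b-diagonal a = ℕ→ℚ-*-cancelˡ (suc a) (begin
  N * b (suc (suc a)) (suc a)
    ≡⟨ b-step a (suc a) ⟩
  (N + - N) * b (suc a) (suc a) + - (N * b (suc a) a)
    ≡⟨ solve 3 (λ N x y → (N :+ :- N) :* x :+ :- (N :* y) := N :* (:- y)) refl N (b (suc a) (suc a)) (b (suc a) a) ⟩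
  N * - b (suc a) a ∎)
  where
  open ≡-Reasoning
  N : ℚ
  N = ℕ→ℚ (suc a)

Nörlund : ℕ → ℕ → Set
Nörlund m d = ℕ→ℚ ((m +ℕ d) !) * b (suc (m +ℕ d)) d ≡ ℕ→ℚ (m !) * S₁ℚ (suc (m +ℕ d)) (suc m)

-- Multiplying b-step (at p = m + d) by p! and using (N) for the term
-- (m+1) b_{p+1,d} and for the shift term gives the Stirling recurrence.
nörlund-step : ∀ m d → Nörlund m d →
  ℕ→ℚ ((m +ℕ d) !) * shift (β ^PS suc (m +ℕ d)) d ≡ ℕ→ℚ (suc m !) * S₁ℚ (suc (m +ℕ d)) (suc (suc m)) →
  Nörlund (suc m) d
nörlund-step m d ih shift-term = begin
  ℕ→ℚ (suc p !) * b (suc (suc p)) d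
    ≡⟨ cong (_* b (suc (suc p)) d) (ℕ→ℚ-suc-! p) ⟩
  (N * F) * b (suc (suc p)) d
    ≡⟨ solve 3 (λ N F y → (N :* F) :* y := F :* (N :* y)) refl N F (b (suc (suc p)) d) ⟩
  F * (N * b (suc (suc p)) d)
    ≡⟨ cong (F *_) (trans (b-step p d) (cong (λ x → (x + - ℕ→ℚ d) * b (suc p) d + - (N * s)) (ℕ→ℚ-+ (suc m) d))) ⟩
  F * ((M + ℕ→ℚ d + - ℕ→ℚ d) * b (suc p) d + - (N * s))
    ≡⟨ solve 6 (λ F M D x N s → F :* ((M :+ D :+ :- D) :* x :+ :- (N :* s)) := M :* (F :* x) :+ :- (N :* (F :* s)))
               refl F M (ℕ→ℚ d) (b (suc p) d) N s ⟩
  M * (F * b (suc p) d) + - (N * (F * s))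
    ≡⟨ cong₂ (λ x y → M * x + - (N * y)) ih shift-term ⟩
  M * (ℕ→ℚ (m !) * S₁ℚ (suc p) (suc m)) + - (N * (ℕ→ℚ (suc m !) * S₁ℚ (suc p) (suc (suc m))))
    ≡⟨ cong (λ x → M * (ℕ→ℚ (m !) * S₁ℚ (suc p) (suc m)) + - (N * (x * S₁ℚ (suc p) (suc (suc m))))) (ℕ→ℚ-suc-! m) ⟩
  M * (ℕ→ℚ (m !) * S₁ℚ (suc p) (suc m)) + - (N * ((M * ℕ→ℚ (m !)) * S₁ℚ (suc p) (suc (suc m))))
    ≡⟨ solve 5 (λ M G s N s₂ → M :* (G :* s) :+ :- (N :* ((M :* G) :* s₂)) := (M :* G) :* (s :+ :- (N :* s₂)))
               refl M (ℕ→ℚ (m !)) (S₁ℚ (suc p) (suc m)) N (S₁ℚ (suc p) (suc (suc m))) ⟩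
  (M * ℕ→ℚ (m !)) * (S₁ℚ (suc p) (suc m) + - (N * S₁ℚ (suc p) (suc (suc m))))
    ≡⟨ cong₂ _*_ (sym (ℕ→ℚ-suc-! m)) (sym (S₁ℚ-recurrence (suc p) (suc m))) ⟩
  ℕ→ℚ (suc m !) * S₁ℚ (suc (suc p)) (suc (suc m)) ∎
  where
  open ≡-Reasoning
  p : ℕ
  p = m +ℕ d
  N F M s : ℚ
  N = ℕ→ℚ (suc p)
  F = ℕ→ℚ (p !)
  M = ℕ→ℚ (suc m)
  s = shift (β ^PS suc p) d

-- Induction on m, and on d inside: the shift term vanishes for d = 0
-- (S₁(m+1, m+2) = 0) and is (N) at (m+1, d-1) otherwise.
nörlund : ∀ m d → Nörlund m d
nörlund zero    zero    = cong (1ℚ *_) (b-constant 1)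
nörlund zero    (suc d) = begin
  ℕ→ℚ (suc d !) * b (suc (suc d)) (suc d)
    ≡⟨ cong₂ _*_ (ℕ→ℚ-suc-! d) (b-diagonal d) ⟩
  (N * ℕ→ℚ (d !)) * - b (suc d) d
    ≡⟨ solve 3 (λ N f x → (N :* f) :* (:- x) := con 1ℚ :* (con 0ℚ :+ :- (N :* (f :* x)))) refl N (ℕ→ℚ (d !)) (b (suc d) d) ⟩
  1ℚ * (0ℚ + - (N * (ℕ→ℚ (d !) * b (suc d) d)))
    ≡⟨ cong (λ x → 1ℚ * (0ℚ + - (N * x))) (trans (nörlund zero d) (*-identityˡ (S₁ℚ (suc d) 1))) ⟩
  1ℚ * (0ℚ + - (N * S₁ℚ (suc d) 1))
    ≡⟨ cong (1ℚ *_) (sym (S₁ℚ-recurrence (suc d) 0)) ⟩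
  1ℚ * S₁ℚ (suc (suc d)) 1 ∎
  where
  open ≡-Reasoning
  N : ℚ
  N = ℕ→ℚ (suc d)
nörlund (suc m) zero     = nörlund-step m zero (nörlund m zero) (begin
  ℕ→ℚ ((m +ℕ 0) !) * 0ℚ                              ≡⟨ *-zeroʳ (ℕ→ℚ ((m +ℕ 0) !)) ⟩
  0ℚ                                                 ≡⟨ sym (*-zeroʳ (ℕ→ℚ (suc m !))) ⟩
  ℕ→ℚ (suc m !) * 0ℚ                                 ≡⟨ cong (ℕ→ℚ (suc m !) *_) (sym (S₁ℚ-vanish _ _ m+0<m+1)) ⟩
  ℕ→ℚ (suc m !) * S₁ℚ (suc (m +ℕ 0)) (suc (suc m))   ∎)
  where
  open ≡-Reasoning
  m+0<m+1 : suc (m +ℕ 0) < suc (suc m)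
  m+0<m+1 = s≤s (s≤s (ℕP.≤-reflexive (ℕP.+-identityʳ m)))
nörlund (suc m) (suc d′) = nörlund-step m (suc d′) (nörlund m (suc d′))
  (subst (λ q → ℕ→ℚ (q !) * b (suc q) d′ ≡ ℕ→ℚ (suc m !) * S₁ℚ (suc q) (suc (suc m)))
         (sym (ℕP.+-suc m d′)) (nörlund (suc m) d′))

nörlund-at : ∀ m d q → m +ℕ d ≡ q → ℕ→ℚ (q !) * b (suc q) d ≡ ℕ→ℚ (m !) * S₁ℚ (suc q) (suc m)
nörlund-at m d .(m +ℕ d) refl = nörlund m d

-- Since (1+t) θL = t, θ(L^(m+1)) = (m+1) L^m θL gives
-- (n+1) [t^(n+1)] L^(m+1) + n [t^n] L^(m+1) = (m+1) [t^n] L^m,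
-- which is the Stirling recurrence for n! [t^n] L^m / m!.
θlog1p⊕shift : (θ log1p ⊕ shift (θ log1p)) ≗ shift onePS
θlog1p⊕shift zero          = refl
θlog1p⊕shift (suc zero)    = refl
θlog1p⊕shift (suc (suc i)) = begin
  θ log1p (suc (suc i)) + θ log1p (suc i)
    ≡⟨ cong₂ _+_ (θlog1p-suc (suc i)) (θlog1p-suc i) ⟩
  - 1ℚ * sgn i + sgn i
    ≡⟨ solve 1 (λ s → :- con 1ℚ :* s :+ s := con 0ℚ) refl (sgn i) ⟩
  0ℚ ∎
  where
  open ≡-Reasoning
  θlog1p-suc : ∀ i → θ log1p (suc i) ≡ sgn i
  θlog1p-suc i = begin
    ℕ→ℚ (suc i) * (sgn i * recip (suc i))
      ≡⟨ solve 3 (λ a s v → a :* (s :* v) := s :* (v :* a)) refl (ℕ→ℚ (suc i)) (sgn i) (recip (suc i)) ⟩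
    sgn i * (recip (suc i) * ℕ→ℚ (suc i))
      ≡⟨ cong (sgn i *_) (recip-inverse (suc i)) ⟩
    sgn i * 1ℚ
      ≡⟨ *-identityʳ (sgn i) ⟩
    sgn i ∎

log-power-recurrence : ∀ m n →
  ℕ→ℚ (suc n) * (log1p ^PS suc m) (suc n) + ℕ→ℚ n * (log1p ^PS suc m) n ≡ ℕ→ℚ (suc m) * (log1p ^PS m) n
log-power-recurrence m n = begin
  θ Lᵐ⁺¹ (suc n) + θ Lᵐ⁺¹ n
    ≡⟨ cong₂ _+_ (θ-pow log1p m (suc n)) (θ-pow log1p m n) ⟩
  c * (Lᵐ ⊛ θ log1p) (suc n) + c * (Lᵐ ⊛ θ log1p) n
    ≡⟨ sym (*-distribˡ-+ c _ _) ⟩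
  c * ((Lᵐ ⊛ θ log1p) (suc n) + shift (Lᵐ ⊛ θ log1p) (suc n))
    ≡⟨ cong (λ x → c * ((Lᵐ ⊛ θ log1p) (suc n) + x)) (sym (⊛-shiftʳ Lᵐ (θ log1p) (suc n))) ⟩
  c * ((Lᵐ ⊛ θ log1p) (suc n) + (Lᵐ ⊛ shift (θ log1p)) (suc n))
    ≡⟨ cong (c *_) (sym (⊛-distribˡ-⊕ Lᵐ (θ log1p) (shift (θ log1p)) (suc n))) ⟩
  c * (Lᵐ ⊛ (θ log1p ⊕ shift (θ log1p))) (suc n)
    ≡⟨ cong (c *_) (⊛-congʳ Lᵐ θlog1p⊕shift (suc n)) ⟩
  c * (Lᵐ ⊛ shift onePS) (suc n)
    ≡⟨ cong (c *_) (trans (⊛-shiftʳ Lᵐ onePS (suc n)) (⊛-identityʳ Lᵐ n)) ⟩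
  c * Lᵐ n ∎
  where
  open ≡-Reasoning
  c : ℚ
  c = ℕ→ℚ (suc m)
  Lᵐ Lᵐ⁺¹ : PS
  Lᵐ = log1p ^PS m
  Lᵐ⁺¹ = log1p ^PS suc m

log-power-coefficient : ∀ m n → ℕ→ℚ (n !) * (log1p ^PS m) n ≡ ℕ→ℚ (m !) * S₁ℚ n m
log-power-coefficient zero    zero    = refl
log-power-coefficient zero    (suc n) = trans (*-zeroʳ (ℕ→ℚ (suc n !))) (sym (*-zeroʳ 1ℚ))
log-power-coefficient (suc m) zero    =
  trans (cong (1ℚ *_) constant-term) (trans (*-zeroʳ 1ℚ) (sym (*-zeroʳ (ℕ→ℚ (suc m !)))))
  where
  constant-term : (log1p ^PS suc m) 0 ≡ 0ℚ
  constant-term = trans (⊛-def log1p (log1p ^PS m) 0)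
                     (trans (+-identityʳ _) (*-zeroˡ ((log1p ^PS m) 0)))
log-power-coefficient (suc m) (suc n) = begin
  ℕ→ℚ (suc n !) * x
    ≡⟨ cong (_* x) (ℕ→ℚ-suc-! n) ⟩
  (ℕ→ℚ (suc n) * F) * x
    ≡⟨ solve 3 (λ N F x → (N :* F) :* x := F :* (N :* x)) refl (ℕ→ℚ (suc n)) F x ⟩
  F * (ℕ→ℚ (suc n) * x)
    ≡⟨ cong (F *_) (trans (solve 2 (λ a y → a := (a :+ y) :+ :- y) refl (ℕ→ℚ (suc n) * x) (ℕ→ℚ n * y))
                          (cong (_+ - (ℕ→ℚ n * y)) (log-power-recurrence m n))) ⟩
  F * (M * z + - (ℕ→ℚ n * y))
    ≡⟨ solve 5 (λ F M z N y → F :* (M :* z :+ :- (N :* y)) := M :* (F :* z) :+ :- (N :* (F :* y))) refl F M z (ℕ→ℚ n) y ⟩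
  M * (F * z) + - (ℕ→ℚ n * (F * y))
    ≡⟨ cong₂ (λ u v → M * u + - (ℕ→ℚ n * v)) (log-power-coefficient m n)
             (trans (log-power-coefficient (suc m) n) (cong (_* S₁ℚ n (suc m)) (ℕ→ℚ-suc-! m))) ⟩
  M * (ℕ→ℚ (m !) * S₁ℚ n m) + - (ℕ→ℚ n * ((M * ℕ→ℚ (m !)) * S₁ℚ n (suc m)))
    ≡⟨ solve 5 (λ M G s N s₂ → M :* (G :* s) :+ :- (N :* ((M :* G) :* s₂)) := (M :* G) :* (s :+ :- (N :* s₂)))
               refl M (ℕ→ℚ (m !)) (S₁ℚ n m) (ℕ→ℚ n) (S₁ℚ n (suc m)) ⟩
  (M * ℕ→ℚ (m !)) * (S₁ℚ n m + - (ℕ→ℚ n * S₁ℚ n (suc m)))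
    ≡⟨ cong₂ _*_ (sym (ℕ→ℚ-suc-! m)) (sym (S₁ℚ-recurrence n m)) ⟩
  ℕ→ℚ (suc m !) * S₁ℚ (suc n) (suc m) ∎
  where
  open ≡-Reasoning
  F M x y z : ℚ
  F = ℕ→ℚ (n !)
  M = ℕ→ℚ (suc m)
  x = (log1p ^PS suc m) (suc n)
  y = (log1p ^PS suc m) n
  z = (log1p ^PS m) n

-- Sums over n-tuples: expanding the n-fold product βⁿ = β ⋯ β coefficientwise
-- gives Σ_{l₁+⋯+lₙ=l} β_{l₁} ⋯ β_{lₙ} = [t^l] βⁿ; with β_l = B_l / l! the
-- multinomial sums of the theorem become Stirling numbers by (N).
Σtuples-suc : ∀ n l F → Σtuples (suc n) l F ≡ Σ< (suc l) (λ i → Σtuples n (l ∸ i) (λ ls → F (i ∷ ls)))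
Σtuples-suc n l F = trans (sum-concatMap F (λ i → map (i ∷_) (tuples n (l ∸ i))) (upTo (suc l)))
  (trans (sum-upTo (suc l) (λ i → sumℚ (map F (map (i ∷_) (tuples n (l ∸ i))))))
         (Σ<-cong (suc l) (λ i → sum-map-map F (i ∷_) (tuples n (l ∸ i)))))

prodβ : List ℕ → ℚ
prodβ ls = prodℚ (map β ls)

Σtuples-prodβ : ∀ n l → Σtuples n l prodβ ≡ b n l
Σtuples-prodβ zero    zero    = refl
Σtuples-prodβ zero    (suc l) = refl
Σtuples-prodβ (suc n) l = begin
  Σtuples (suc n) l prodβ
    ≡⟨ Σtuples-suc n l prodβ ⟩
  Σ< (suc l) (λ i → Σtuples n (l ∸ i) (λ ls → β i * prodβ ls))
    ≡⟨ Σ<-cong (suc l) (λ i → trans (sym (sum-*ˡ (β i) prodβ (tuples n (l ∸ i))))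
                                     (cong (β i *_) (Σtuples-prodβ n (l ∸ i)))) ⟩
  Σ< (suc l) (λ i → β i * b n (l ∸ i))
    ≡⟨ sym (⊛-def β (β ^PS n) l) ⟩
  b (suc n) l ∎
  where open ≡-Reasoning

factorials : List ℕ → ℕ
factorials = foldr (λ x r → (x !) *ℕ r) 1

recip-factorials-prodB : ∀ ls → recip (factorials ls) * prodB ls ≡ prodβ ls
recip-factorials-prodB []       = refl
recip-factorials-prodB (x ∷ xs) = begin
  recip (x ! *ℕ factorials xs) * (B x * prodB xs)
    ≡⟨ cong (_* (B x * prodB xs)) (recip-* (x !) (factorials xs)) ⟩
  (recip (x !) * recip (factorials xs)) * ((ℕ→ℚ (x !) * β x) * prodB xs)
    ≡⟨ solve 5 (λ a d f y p → (a :* d) :* ((f :* y) :* p) := ((a :* f) :* y) :* (d :* p)) refl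
               (recip (x !)) (recip (factorials xs)) (ℕ→ℚ (x !)) (β x) (prodB xs) ⟩
  ((recip (x !) * ℕ→ℚ (x !)) * β x) * (recip (factorials xs) * prodB xs)
    ≡⟨ cong₂ (λ u v → (u * β x) * v) (recip-fact-inverse x) (recip-factorials-prodB xs) ⟩
  (1ℚ * β x) * prodβ xs
    ≡⟨ cong (_* prodβ xs) (*-identityˡ (β x)) ⟩
  β x * prodβ xs ∎
  where open ≡-Reasoning

multinom-prodB : ∀ n l ls →
  multinom n l ls * prodB ls ≡ (ℕ→ℚ ((n ∸ 1) !) * recip ((n ∸ 1 ∸ l) !)) * prodβ ls
multinom-prodB n l ls = begin
  multinom n l ls * prodB ls
    ≡⟨ cong (_* prodB ls) (trans (÷ℕ-as-recip ((n ∸ 1) !) (factorials ls *ℕ R))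
                                 (cong (A *_) (recip-* (factorials ls) R))) ⟩
  (A * (recip (factorials ls) * recip R)) * prodB ls
    ≡⟨ solve 4 (λ A d r p → (A :* (d :* r)) :* p := (A :* r) :* (d :* p)) refl A (recip (factorials ls)) (recip R) (prodB ls) ⟩
  (A * recip R) * (recip (factorials ls) * prodB ls)
    ≡⟨ cong ((A * recip R) *_) (recip-factorials-prodB ls) ⟩
  (A * recip R) * prodβ ls ∎
  where
  open ≡-Reasoning
  R : ℕ
  R = (n ∸ 1 ∸ l) !
  A : ℚ
  A = ℕ→ℚ ((n ∸ 1) !)

multinomial-stirling : ∀ n′ l → l ≤ n′ →
  Σtuples (suc n′) l (λ ls → multinom (suc n′) l ls * prodB ls) ≡ S₁ℚ (suc n′) (suc (n′ ∸ l))
multinomial-stirling n′ l l≤n′ = begin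
  Σtuples (suc n′) l (λ ls → multinom (suc n′) l ls * prodB ls)
    ≡⟨ sum-cong (tuples (suc n′) l) (multinom-prodB (suc n′) l) ⟩
  Σtuples (suc n′) l (λ ls → (ℕ→ℚ (n′ !) * recip (M !)) * prodβ ls)
    ≡⟨ sym (sum-*ˡ (ℕ→ℚ (n′ !) * recip (M !)) prodβ (tuples (suc n′) l)) ⟩
  (ℕ→ℚ (n′ !) * recip (M !)) * Σtuples (suc n′) l prodβ
    ≡⟨ cong (ℕ→ℚ (n′ !) * recip (M !) *_) (Σtuples-prodβ (suc n′) l) ⟩
  (ℕ→ℚ (n′ !) * recip (M !)) * b (suc n′) l
    ≡⟨ solve 3 (λ a v x → (a :* v) :* x := v :* (a :* x)) refl (ℕ→ℚ (n′ !)) (recip (M !)) (b (suc n′) l) ⟩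
  recip (M !) * (ℕ→ℚ (n′ !) * b (suc n′) l)
    ≡⟨ cong (recip (M !) *_) (nörlund-at M l n′ (ℕP.m∸n+n≡m l≤n′)) ⟩
  recip (M !) * (ℕ→ℚ (M !) * S₁ℚ (suc n′) (suc M))
    ≡⟨ sym (*-assoc (recip (M !)) (ℕ→ℚ (M !)) _) ⟩
  (recip (M !) * ℕ→ℚ (M !)) * S₁ℚ (suc n′) (suc M)
    ≡⟨ trans (cong (_* S₁ℚ (suc n′) (suc M)) (recip-fact-inverse M)) (*-identityˡ _) ⟩
  S₁ℚ (suc n′) (suc M) ∎
  where
  open ≡-Reasoning
  M : ℕ
  M = n′ ∸ l

lah : ℕ → ℕ → ℕ
lah zero    zero    = 1
lah zero    (suc a) = 0
lah (suc n) zero    = 0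
lah (suc n) (suc a) = lah n a +ℕ (n +ℕ suc a) *ℕ lah n (suc a)

lah-vanish : ∀ n a → n < a → lah n a ≡ 0
lah-vanish zero    (suc a) _ = refl
lah-vanish (suc n) (suc a) (s≤s n<a)
  rewrite lah-vanish n a n<a | lah-vanish n (suc a) (ℕP.m<n⇒m<1+n n<a) = ℕP.*-zeroʳ (n +ℕ suc a)

lah-column-1 : ∀ n → lah (suc n) 1 ≡ suc n !
lah-column-1 zero    = refl
lah-column-1 (suc n) rewrite lah-column-1 n = cong (_*ℕ suc n !) (ℕP.+-comm (suc n) 1)

lah-diagonal : ∀ n → lah n n ≡ 1
lah-diagonal zero    = refl
lah-diagonal (suc n) rewrite lah-diagonal n | lah-vanish n (suc n) (ℕP.n<1+n n) =
  cong suc (ℕP.*-zeroʳ (n +ℕ suc n))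

-- closed form L(t+1,a+1) (a+1)! a! d! = (t+1)! t!  for t = a + d, cleared of denominators
LahClosedForm : ℕ → ℕ → ℕ → Set
LahClosedForm a d t = lah (suc t) (suc a) *ℕ (suc a ! *ℕ (a ! *ℕ d !)) ≡ suc t ! *ℕ t !

private
  -- the recurrence, with factorials unfolded (x = a!, y = d!)
  lah-regroup : ∀ u v a d x y →
    (u +ℕ (suc (suc (a +ℕ d)) +ℕ suc (suc a)) *ℕ v) *ℕ ((suc (suc a) *ℕ (suc a *ℕ x)) *ℕ ((suc a *ℕ x) *ℕ (suc d *ℕ y)))
    ≡ (suc (suc a) *ℕ suc a) *ℕ (u *ℕ ((suc a *ℕ x) *ℕ (x *ℕ (suc d *ℕ y))))
      +ℕ (suc (suc (a +ℕ d)) +ℕ suc (suc a)) *ℕ suc d *ℕ (v *ℕ ((suc (suc a) *ℕ (suc a *ℕ x)) *ℕ ((suc a *ℕ x) *ℕ y)))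
  lah-regroup = solve-∀

  -- (a+2)(a+1) + (2a+d+4)(d+1) = (a+d+3)(a+d+2), with w = (a+d)!
  lah-coefficient : ∀ a d w →
    (suc (suc a) *ℕ suc a) *ℕ ((suc (suc (a +ℕ d)) *ℕ (suc (a +ℕ d) *ℕ w)) *ℕ (suc (a +ℕ d) *ℕ w))
    +ℕ (suc (suc (a +ℕ d)) +ℕ suc (suc a)) *ℕ suc d *ℕ ((suc (suc (a +ℕ d)) *ℕ (suc (a +ℕ d) *ℕ w)) *ℕ (suc (a +ℕ d) *ℕ w))
    ≡ (suc (suc (suc (a +ℕ d))) *ℕ (suc (suc (a +ℕ d)) *ℕ (suc (a +ℕ d) *ℕ w))) *ℕ (suc (suc (a +ℕ d)) *ℕ (suc (a +ℕ d) *ℕ w))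
  lah-coefficient = solve-∀

  lah-closed-form-step : ∀ a d → LahClosedForm a (suc d) (suc (a +ℕ d)) → LahClosedForm (suc a) d (suc (a +ℕ d)) →
                         LahClosedForm (suc a) (suc d) (suc (suc (a +ℕ d)))
  lah-closed-form-step a d ih₁ ih₂ = begin
    (u +ℕ (N +ℕ suc (suc a)) *ℕ v) *ℕ (suc (suc a) ! *ℕ (suc a ! *ℕ suc d !))
      ≡⟨ lah-regroup u v a d (a !) (d !) ⟩
    (suc (suc a) *ℕ suc a) *ℕ (u *ℕ (suc a ! *ℕ (a ! *ℕ suc d !)))
      +ℕ (N +ℕ suc (suc a)) *ℕ suc d *ℕ (v *ℕ (suc (suc a) ! *ℕ (suc a ! *ℕ d !)))
      ≡⟨ cong₂ (λ p q → (suc (suc a) *ℕ suc a) *ℕ p +ℕ (N +ℕ suc (suc a)) *ℕ suc d *ℕ q) ih₁ ih₂ ⟩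
    (suc (suc a) *ℕ suc a) *ℕ (N ! *ℕ suc (a +ℕ d) !) +ℕ (N +ℕ suc (suc a)) *ℕ suc d *ℕ (N ! *ℕ suc (a +ℕ d) !)
      ≡⟨ lah-coefficient a d ((a +ℕ d) !) ⟩
    suc N ! *ℕ N ! ∎
    where
    open ≡-Reasoning
    N u v : ℕ
    N = suc (suc (a +ℕ d))
    u = lah N (suc a)
    v = lah N (suc (suc a))

lah-closed-form : ∀ a d → LahClosedForm a d (a +ℕ d)
lah-closed-form zero    d rewrite lah-column-1 d =
  cong (suc d ! *ℕ_) (trans (ℕP.*-identityˡ (1 *ℕ d !)) (ℕP.*-identityˡ (d !)))
lah-closed-form (suc a) zero rewrite ℕP.+-identityʳ a | lah-diagonal (suc (suc a)) =
  trans (ℕP.*-identityˡ _) (cong (suc (suc a) ! *ℕ_) (ℕP.*-identityʳ (suc a !)))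
lah-closed-form (suc a) (suc d) = subst (LahClosedForm (suc a) (suc d)) (sym (cong suc (ℕP.+-suc a d)))
  (lah-closed-form-step a d (subst (LahClosedForm a (suc d)) (ℕP.+-suc a d) (lah-closed-form a (suc d)))
                            (lah-closed-form (suc a) d))

binomial-factorials : ∀ n k → k ≤ n → (n C k) *ℕ (k ! *ℕ (n ∸ k) !) ≡ n !
binomial-factorials n k k≤n = trans (cong (_*ℕ (k ! *ℕ (n ∸ k) !)) (nCk≡n!/k![n-k]! k≤n))
  (m/n*n≡m {{ℕP._!*_!≢0 k (n ∸ k)}} (k![n∸k]!∣n! k≤n))

lah-closed-formℚ : ∀ n a → a ≤ n → ℕ→ℚ (lah (suc n) (suc a)) ≡ ℕ→ℚ (suc n !) * recip (suc a !) * binℚ n a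
lah-closed-formℚ n a a≤n =
  subst (λ t → ℕ→ℚ (lah (suc t) (suc a)) ≡ ℕ→ℚ (suc t !) * recip (suc a !) * binℚ t a)
        (ℕP.m+[n∸m]≡n a≤n) (in-terms-of-d (n ∸ a))
  where
  in-terms-of-d : ∀ d → ℕ→ℚ (lah (suc (a +ℕ d)) (suc a)) ≡ ℕ→ℚ (suc (a +ℕ d) !) * recip (suc a !) * binℚ (a +ℕ d) a
  in-terms-of-d d = ℕ→ℚ-*-cancelˡ X {{ℕP.m*n≢0 A Y {{ℕP._!≢0 (suc a)}} {{ℕP._!*_!≢0 a d}}}} (begin
    ℕ→ℚ X * ℕ→ℚ Lh
      ≡⟨ sym (ℕ→ℚ-* X Lh) ⟩
    ℕ→ℚ (X *ℕ Lh)
      ≡⟨ cong ℕ→ℚ (trans (ℕP.*-comm X Lh) (lah-closed-form a d)) ⟩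
    ℕ→ℚ (T₁ *ℕ T₀)
      ≡⟨ cong (λ z → ℕ→ℚ (T₁ *ℕ z)) (sym (binomial-factorials′)) ⟩
    ℕ→ℚ (T₁ *ℕ (Cn *ℕ Y))
      ≡⟨ trans (ℕ→ℚ-* T₁ (Cn *ℕ Y)) (cong (ℕ→ℚ T₁ *_) (ℕ→ℚ-* Cn Y)) ⟩
    ℕ→ℚ T₁ * (ℕ→ℚ Cn * ℕ→ℚ Y)
      ≡⟨ sym (trans (cong (_* (ℕ→ℚ T₁ * (ℕ→ℚ Cn * ℕ→ℚ Y))) (trans (*-comm (ℕ→ℚ A) (recip A)) (recip-fact-inverse (suc a))))
                    (*-identityˡ _)) ⟩
    (ℕ→ℚ A * recip A) * (ℕ→ℚ T₁ * (ℕ→ℚ Cn * ℕ→ℚ Y))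
      ≡⟨ solve 5 (λ A iA T Cn Y → (A :* iA) :* (T :* (Cn :* Y)) := (A :* Y) :* (T :* iA :* Cn)) refl
                 (ℕ→ℚ A) (recip A) (ℕ→ℚ T₁) (ℕ→ℚ Cn) (ℕ→ℚ Y) ⟩
    (ℕ→ℚ A * ℕ→ℚ Y) * (ℕ→ℚ T₁ * recip A * ℕ→ℚ Cn)
      ≡⟨ cong (_* (ℕ→ℚ T₁ * recip A * ℕ→ℚ Cn)) (sym (ℕ→ℚ-* A Y)) ⟩
    ℕ→ℚ X * (ℕ→ℚ T₁ * recip A * ℕ→ℚ Cn) ∎)
    where
    open ≡-Reasoning
    A Y X Lh T₁ T₀ Cn : ℕ
    A = suc a !
    Y = a ! *ℕ d !
    X = A *ℕ Y
    Lh = lah (suc (a +ℕ d)) (suc a)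
    T₁ = suc (a +ℕ d) !
    T₀ = (a +ℕ d) !
    Cn = (a +ℕ d) C a
    binomial-factorials′ : Cn *ℕ Y ≡ T₀
    binomial-factorials′ = trans (cong (λ x → Cn *ℕ (a ! *ℕ x !)) (sym (ℕP.m+n∸m≡n a d)))
                                 (binomial-factorials (a +ℕ d) a (ℕP.m≤m+n a d))

lahStirling : ℕ → ℕ → ℚ
lahStirling n m = Σ< (suc n) (λ a → ℕ→ℚ (lah n a) * S₁ℚ a m)

-- Inserting both recurrences, the terms (n+a) L(n,a) S₁(a,m+1) telescope
-- (they vanish at a = 0 and a = n+1), leaving a + (n+a) ↦ n.
lahStirling-step : ∀ n m → lahStirling (suc n) (suc m) ≡ lahStirling n m + ℕ→ℚ n * lahStirling n (suc m)
lahStirling-step n m = begin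
  lahStirling (suc n) (suc m)
    ≡⟨ +-identityˡ _ ⟩
  Σ< (suc n) (λ a → ℕ→ℚ (lah (suc n) (suc a)) * S₁ℚ (suc a) (suc m))
    ≡⟨ Σ<-cong (suc n) expand ⟩
  Σ< (suc n) (λ a → ℕ→ℚ (lah n a) * S₁ℚ a m + (- (ℕ→ℚ a * h a) + g (suc a)))
    ≡⟨ trans (Σ<-+ (suc n) (λ a → ℕ→ℚ (lah n a) * S₁ℚ a m) (λ a → - (ℕ→ℚ a * h a) + g (suc a)))
             (cong (λ s → lahStirling n m + s) (Σ<-+ (suc n) (λ a → - (ℕ→ℚ a * h a)) (λ a → g (suc a)))) ⟩
  lahStirling n m + (Σ< (suc n) (λ a → - (ℕ→ℚ a * h a)) + Σ< (suc n) (λ a → g (suc a)))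
    ≡⟨ cong (λ x → lahStirling n m + (Σ< (suc n) (λ a → - (ℕ→ℚ a * h a)) + x)) telescope ⟩
  lahStirling n m + (Σ< (suc n) (λ a → - (ℕ→ℚ a * h a)) + Σ< (suc n) g)
    ≡⟨ cong (λ s → lahStirling n m + s) (sym (Σ<-+ (suc n) (λ a → - (ℕ→ℚ a * h a)) g)) ⟩
  lahStirling n m + Σ< (suc n) (λ a → - (ℕ→ℚ a * h a) + g a)
    ≡⟨ cong (λ s → lahStirling n m + s) (Σ<-cong (suc n) collect) ⟩
  lahStirling n m + Σ< (suc n) (λ a → ℕ→ℚ n * h a)
    ≡⟨ cong (λ s → lahStirling n m + s) (sym (Σ<-*ˡ (suc n) (ℕ→ℚ n) h)) ⟩
  lahStirling n m + ℕ→ℚ n * lahStirling n (suc m) ∎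
  where
  open ≡-Reasoning
  h g : ℕ → ℚ
  h a = ℕ→ℚ (lah n a) * S₁ℚ a (suc m)
  g a = ℕ→ℚ (n +ℕ a) * h a
  expand : ∀ a → ℕ→ℚ (lah (suc n) (suc a)) * S₁ℚ (suc a) (suc m)
                 ≡ ℕ→ℚ (lah n a) * S₁ℚ a m + (- (ℕ→ℚ a * h a) + g (suc a))
  expand a = begin
    ℕ→ℚ (lah n a +ℕ (n +ℕ suc a) *ℕ lah n (suc a)) * Z
      ≡⟨ cong (_* Z) (trans (ℕ→ℚ-+ (lah n a) _) (cong (λ s → La + s) (ℕ→ℚ-* (n +ℕ suc a) (lah n (suc a))))) ⟩
    (La + ℕ→ℚ (n +ℕ suc a) * ℕ→ℚ (lah n (suc a))) * Z
      ≡⟨ solve 4 (λ La Nb Lb Z → (La :+ Nb :* Lb) :* Z := La :* Z :+ Nb :* (Lb :* Z)) refl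
                 La (ℕ→ℚ (n +ℕ suc a)) (ℕ→ℚ (lah n (suc a))) Z ⟩
    La * Z + g (suc a)
      ≡⟨ cong (λ z → La * z + g (suc a)) (S₁ℚ-recurrence a m) ⟩
    La * (S₁ℚ a m + - (ℕ→ℚ a * S₁ℚ a (suc m))) + g (suc a)
      ≡⟨ solve 5 (λ La x A y G → La :* (x :+ :- (A :* y)) :+ G := La :* x :+ (:- (A :* (La :* y)) :+ G)) refl
                 La (S₁ℚ a m) (ℕ→ℚ a) (S₁ℚ a (suc m)) (g (suc a)) ⟩
    La * S₁ℚ a m + (- (ℕ→ℚ a * h a) + g (suc a)) ∎
    where
    La Z : ℚ
    La = ℕ→ℚ (lah n a)
    Z = S₁ℚ (suc a) (suc m)
  telescope : Σ< (suc n) (λ a → g (suc a)) ≡ Σ< (suc n) g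
  telescope = begin
    Σ< (suc n) (λ a → g (suc a))       ≡⟨ sym (+-identityˡ _) ⟩
    0ℚ + Σ< (suc n) (λ a → g (suc a))  ≡⟨ cong (_+ Σ< (suc n) (λ a → g (suc a))) (sym g-first) ⟩
    Σ< (suc (suc n)) g                 ≡⟨ Σ<-snoc (suc n) g ⟩
    Σ< (suc n) g + g (suc n)           ≡⟨ trans (cong (λ s → Σ< (suc n) g + s) g-last) (+-identityʳ _) ⟩
    Σ< (suc n) g                       ∎
    where
    g-first : g 0 ≡ 0ℚ
    g-first = trans (cong (λ z → ℕ→ℚ (n +ℕ 0) * (ℕ→ℚ (lah n 0) * z)) (S₁ℚ-vanish 0 (suc m) (s≤s z≤n)))
                    (trans (cong (ℕ→ℚ (n +ℕ 0) *_) (*-zeroʳ (ℕ→ℚ (lah n 0)))) (*-zeroʳ (ℕ→ℚ (n +ℕ 0))))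
    g-last : g (suc n) ≡ 0ℚ
    g-last = trans (cong (λ z → ℕ→ℚ (n +ℕ suc n) * (ℕ→ℚ z * S₁ℚ (suc n) (suc m))) (lah-vanish n (suc n) (ℕP.n<1+n n)))
                   (trans (cong (ℕ→ℚ (n +ℕ suc n) *_) (*-zeroˡ (S₁ℚ (suc n) (suc m)))) (*-zeroʳ (ℕ→ℚ (n +ℕ suc n))))
  collect : ∀ a → - (ℕ→ℚ a * h a) + g a ≡ ℕ→ℚ n * h a
  collect a = trans (cong (λ x → - (ℕ→ℚ a * h a) + x * h a) (trans (ℕ→ℚ-+ n a) (+-comm (ℕ→ℚ n) (ℕ→ℚ a))))
                    (solve 3 (λ A N H → :- (A :* H) :+ (A :+ N) :* H := N :* H) refl (ℕ→ℚ a) (ℕ→ℚ n) (h a))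

lah-inversion : ∀ n m → lahStirling n m ≡ sgn (n +ℕ m) * S₁ℚ n m
lah-inversion zero    zero    = refl
lah-inversion zero    (suc m) = trans (+-identityʳ _) (trans (*-zeroʳ 1ℚ) (sym (*-zeroʳ (sgn (suc m)))))
lah-inversion (suc n) zero    =
  trans (+-identityˡ _) (trans (Σ<-vanish (suc n) _ (λ a _ → *-zeroʳ (ℕ→ℚ (lah (suc n) (suc a)))))
                               (sym (*-zeroʳ (sgn (suc n +ℕ 0)))))
lah-inversion (suc n) (suc m) = begin
  lahStirling (suc n) (suc m)
    ≡⟨ lahStirling-step n m ⟩
  lahStirling n m + ℕ→ℚ n * lahStirling n (suc m)
    ≡⟨ cong₂ (λ x y → x + ℕ→ℚ n * y) (lah-inversion n m) (lah-inversion n (suc m)) ⟩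
  s * S₁ℚ n m + ℕ→ℚ n * (sgn (n +ℕ suc m) * S₁ℚ n (suc m))
    ≡⟨ cong (λ z → s * S₁ℚ n m + ℕ→ℚ n * (sgn z * S₁ℚ n (suc m))) (ℕP.+-suc n m) ⟩
  s * S₁ℚ n m + ℕ→ℚ n * ((- 1ℚ * s) * S₁ℚ n (suc m))
    ≡⟨ solve 4 (λ s x N y → s :* x :+ N :* ((:- con 1ℚ :* s) :* y) := (:- con 1ℚ :* (:- con 1ℚ :* s)) :* (x :+ :- (N :* y)))
               refl s (S₁ℚ n m) (ℕ→ℚ n) (S₁ℚ n (suc m)) ⟩
  (- 1ℚ * (- 1ℚ * s)) * (S₁ℚ n m + - (ℕ→ℚ n * S₁ℚ n (suc m)))
    ≡⟨ cong₂ _*_ (cong (λ z → - 1ℚ * sgn z) (sym (ℕP.+-suc n m))) (sym (S₁ℚ-recurrence n m)) ⟩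
  sgn (suc n +ℕ suc m) * S₁ℚ (suc n) (suc m) ∎
  where
  open ≡-Reasoning
  s : ℚ
  s = sgn (n +ℕ m)

binomial-nörlund : ∀ a′ l → l ≤ a′ → binℚ a′ l * Bord (a′ ∸ l) (suc a′) ≡ S₁ℚ (suc a′) (suc l)
binomial-nörlund a′ l l≤a′ = ℕ→ℚ-*-cancelˡ (l !) {{ℕP._!≢0 l}} (begin
  ℕ→ℚ (l !) * (binℚ a′ l * (ℕ→ℚ (d !) * b (suc a′) d))
    ≡⟨ solve 4 (λ L C D x → L :* (C :* (D :* x)) := (C :* (L :* D)) :* x) refl
               (ℕ→ℚ (l !)) (binℚ a′ l) (ℕ→ℚ (d !)) (b (suc a′) d) ⟩
  (binℚ a′ l * (ℕ→ℚ (l !) * ℕ→ℚ (d !))) * b (suc a′) d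
    ≡⟨ cong (_* b (suc a′) d) (sym (trans (ℕ→ℚ-* (a′ C l) (l ! *ℕ d !)) (cong (binℚ a′ l *_) (ℕ→ℚ-* (l !) (d !))))) ⟩
  ℕ→ℚ ((a′ C l) *ℕ (l ! *ℕ d !)) * b (suc a′) d
    ≡⟨ cong (λ z → ℕ→ℚ z * b (suc a′) d) (binomial-factorials a′ l l≤a′) ⟩
  ℕ→ℚ (a′ !) * b (suc a′) d
    ≡⟨ nörlund-at l d a′ (ℕP.m+[n∸m]≡n l≤a′) ⟩
  ℕ→ℚ (l !) * S₁ℚ (suc a′) (suc l) ∎)
  where
  open ≡-Reasoning
  d : ℕ
  d = a′ ∸ l

lah-stirling-sum : ∀ n′ m′ → m′ ≤ n′ →
  ℕ→ℚ (suc n′ !) * Σ[ suc m′ ⋯ suc n′ ] (λ a → recip (a !) * binℚ n′ (a ∸ 1) * S₁ℚ a (suc m′))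
    ≡ sgn (suc n′ +ℕ suc m′) * S₁ℚ (suc n′) (suc m′)
lah-stirling-sum n′ m′ m′≤n′ = begin
  ℕ→ℚ (suc n′ !) * Σ[ suc m′ ⋯ suc n′ ] (λ a → recip (a !) * binℚ n′ (a ∸ 1) * S₁ℚ a (suc m′))
    ≡⟨ Σ-range-*ˡ (suc m′) (suc n′) (ℕ→ℚ (suc n′ !)) _ ⟩
  Σ[ suc m′ ⋯ suc n′ ] (λ a → ℕ→ℚ (suc n′ !) * (recip (a !) * binℚ n′ (a ∸ 1) * S₁ℚ a (suc m′)))
    ≡⟨ Σ-range-cong (suc m′) (suc n′) (λ { (suc a′) _ a≤n → lah-term a′ (ℕP.≤-pred a≤n) }) ⟩
  Σ[ suc m′ ⋯ suc n′ ] G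
    ≡⟨ sym (Σ-range-from (suc m′) (suc n′) G (s≤s (ℕP.m≤n⇒m≤1+n m′≤n′)) G-vanish) ⟩
  Σ[ 0 ⋯ suc n′ ] G
    ≡⟨ Σ-range 0 (suc n′) G ⟩
  lahStirling (suc n′) (suc m′)
    ≡⟨ lah-inversion (suc n′) (suc m′) ⟩
  sgn (suc n′ +ℕ suc m′) * S₁ℚ (suc n′) (suc m′) ∎
  where
  open ≡-Reasoning
  G : ℕ → ℚ
  G a = ℕ→ℚ (lah (suc n′) a) * S₁ℚ a (suc m′)
  G-vanish : ∀ a → a < suc m′ → G a ≡ 0ℚ
  G-vanish a a<m = trans (cong (ℕ→ℚ (lah (suc n′) a) *_) (S₁ℚ-vanish a (suc m′) a<m)) (*-zeroʳ (ℕ→ℚ (lah (suc n′) a)))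
  lah-term : ∀ a′ → a′ ≤ n′ →
    ℕ→ℚ (suc n′ !) * (recip (suc a′ !) * binℚ n′ a′ * S₁ℚ (suc a′) (suc m′)) ≡ G (suc a′)
  lah-term a′ a′≤n′ = trans
    (solve 4 (λ N i B S → N :* (i :* B :* S) := (N :* i :* B) :* S) refl
             (ℕ→ℚ (suc n′ !)) (recip (suc a′ !)) (binℚ n′ a′) (S₁ℚ (suc a′) (suc m′)))
    (cong (_* S₁ℚ (suc a′) (suc m′)) (sym (lah-closed-formℚ n′ a′ a′≤n′)))

-- the weight of B^(a)_(a-1-l) in the right-hand expressions of the theorem
nörlundTerm : ℕ → ℕ → ℕ → ℚ
nörlundTerm n a l = recip (a !) * binℚ (n ∸ 1) (a ∸ 1) * binℚ (a ∸ 1) l * Bord (a ∸ 1 ∸ l) a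

stirling-nörlund : ∀ n′ m′ → m′ ≤ n′ →
  sgn (suc n′ +ℕ suc m′) * (ℕ→ℚ (suc n′ !) * Σ[ suc m′ ⋯ suc n′ ] (λ a → nörlundTerm (suc n′) a m′))
    ≡ S₁ℚ (suc n′) (suc m′)
stirling-nörlund n′ m′ m′≤n′ = begin
  s * (ℕ→ℚ (suc n′ !) * Σ[ suc m′ ⋯ suc n′ ] (λ a → nörlundTerm (suc n′) a m′))
    ≡⟨ cong (λ x → s * (ℕ→ℚ (suc n′ !) * x)) (Σ-range-cong (suc m′) (suc n′)
         (λ { (suc a′) (s≤s m′≤a′) _ → term a′ m′≤a′ })) ⟩
  s * (ℕ→ℚ (suc n′ !) * Σ[ suc m′ ⋯ suc n′ ] (λ a → recip (a !) * binℚ n′ (a ∸ 1) * S₁ℚ a (suc m′)))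
    ≡⟨ cong (s *_) (lah-stirling-sum n′ m′ m′≤n′) ⟩
  s * (s * S₁ℚ (suc n′) (suc m′))
    ≡⟨ trans (sym (*-assoc s s _)) (trans (cong (_* S₁ℚ (suc n′) (suc m′)) (sgn-square (suc n′ +ℕ suc m′))) (*-identityˡ _)) ⟩
  S₁ℚ (suc n′) (suc m′) ∎
  where
  open ≡-Reasoning
  s : ℚ
  s = sgn (suc n′ +ℕ suc m′)
  term : ∀ a′ → m′ ≤ a′ → nörlundTerm (suc n′) (suc a′) m′ ≡ recip (suc a′ !) * binℚ n′ a′ * S₁ℚ (suc a′) (suc m′)
  term a′ m′≤a′ = trans
    (*-assoc (recip (suc a′ !) * binℚ n′ a′) (binℚ a′ m′) (Bord (a′ ∸ m′) (suc a′)))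
    (cong (recip (suc a′ !) * binℚ n′ a′ *_) (binomial-nörlund a′ m′ m′≤a′))

tuple-expansion : ∀ (w : ℕ → ℚ) n j → 1 ≤ j → j ≤ n →
  Σ[ j ⋯ n ] (λ m → w m * S₁ℚ n m)
    ≡ Σ[ 0 ⋯ n ∸ j ] (λ l → Σtuples n l (λ ls → multinom n l ls * prodB ls * w (n ∸ l)))
tuple-expansion w zero    (suc j′) _ ()
tuple-expansion w (suc n′) j 1≤j j≤n = trans (Σ-range-reverse j (suc n′) _ j≤n)
  (Σ-range-cong 0 (suc n′ ∸ j) (λ l _ l≤ → sym (term l (ℕP.≤-trans l≤ (ℕP.∸-monoʳ-≤ (suc n′) 1≤j)))))
  where
  open ≡-Reasoning
  term : ∀ l → l ≤ n′ →
    Σtuples (suc n′) l (λ ls → multinom (suc n′) l ls * prodB ls * w (suc n′ ∸ l)) ≡ w (suc n′ ∸ l) * S₁ℚ (suc n′) (suc n′ ∸ l)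
  term l l≤n′ = begin
    Σtuples (suc n′) l (λ ls → multinom (suc n′) l ls * prodB ls * w (suc n′ ∸ l))
      ≡⟨ sym (sum-*ʳ (w (suc n′ ∸ l)) (λ ls → multinom (suc n′) l ls * prodB ls) (tuples (suc n′) l)) ⟩
    Σtuples (suc n′) l (λ ls → multinom (suc n′) l ls * prodB ls) * w (suc n′ ∸ l)
      ≡⟨ cong (_* w (suc n′ ∸ l)) (multinomial-stirling n′ l l≤n′) ⟩
    S₁ℚ (suc n′) (suc (n′ ∸ l)) * w (suc n′ ∸ l)
      ≡⟨ cong (λ z → S₁ℚ (suc n′) z * w (suc n′ ∸ l)) (sym (ℕP.+-∸-assoc 1 l≤n′)) ⟩
    S₁ℚ (suc n′) (suc n′ ∸ l) * w (suc n′ ∸ l)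
      ≡⟨ *-comm (S₁ℚ (suc n′) (suc n′ ∸ l)) (w (suc n′ ∸ l)) ⟩
    w (suc n′ ∸ l) * S₁ℚ (suc n′) (suc n′ ∸ l) ∎

sgn-shift : ∀ n e m → e ≤ m → sgn (n +ℕ e) * sgn (m ∸ e) ≡ sgn (n +ℕ m)
sgn-shift n e m e≤m = trans (sym (sgn-+ (n +ℕ e) (m ∸ e)))
  (cong sgn (trans (ℕP.+-assoc n e (m ∸ e)) (cong (n +ℕ_) (ℕP.m+[n∸m]≡n e≤m))))

nörlund-expansion : ∀ (w : ℕ → ℚ) n j e → 1 ≤ j → j ≤ n → e ≤ j →
  Σ[ j ⋯ n ] (λ m → w m * S₁ℚ n m)
    ≡ sgn (n +ℕ e) * ℕ→ℚ (n !) * Σ[ j ⋯ n ] (λ a → Σ[ j ∸ 1 ⋯ a ∸ 1 ] (λ l →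
        sgn (suc l ∸ e) * w (suc l) * nörlundTerm n a l))
nörlund-expansion w (suc n′) (suc j′) e (s≤s z≤n) (s≤s j′≤n′) e≤j = sym (begin
  c * Σ[ suc j′ ⋯ n ] (λ a → Σ[ j′ ⋯ a ∸ 1 ] (G a))
    ≡⟨ cong (c *_) (Σ-range-triangle j′ n′ G) ⟩
  c * Σ[ suc j′ ⋯ n ] (λ m → Σ[ m ⋯ n ] (λ a → G a (m ∸ 1)))
    ≡⟨ Σ-range-*ˡ (suc j′) n c _ ⟩
  Σ[ suc j′ ⋯ n ] (λ m → c * Σ[ m ⋯ n ] (λ a → G a (m ∸ 1)))
    ≡⟨ Σ-range-cong (suc j′) n (λ { (suc m′) j≤m m≤n → term m′ (ℕP.≤-trans e≤j j≤m) (ℕP.≤-pred m≤n) }) ⟩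
  Σ[ suc j′ ⋯ n ] (λ m → w m * S₁ℚ n m) ∎)
  where
  open ≡-Reasoning
  n : ℕ
  n = suc n′
  c : ℚ
  c = sgn (n +ℕ e) * ℕ→ℚ (n !)
  G : ℕ → ℕ → ℚ
  G a l = sgn (suc l ∸ e) * w (suc l) * nörlundTerm n a l
  term : ∀ m′ → e ≤ suc m′ → m′ ≤ n′ → c * Σ[ suc m′ ⋯ n ] (λ a → G a m′) ≡ w (suc m′) * S₁ℚ n (suc m′)
  term m′ e≤m m′≤n′ = begin
    c * Σ[ suc m′ ⋯ n ] (λ a → σ * w (suc m′) * nörlundTerm n a m′)
      ≡⟨ cong (c *_) (sym (Σ-range-*ˡ (suc m′) n (σ * w (suc m′)) (λ a → nörlundTerm n a m′))) ⟩
    c * (σ * w (suc m′) * T)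
      ≡⟨ solve 5 (λ s N σ w T → s :* N :* (σ :* w :* T) := w :* ((s :* σ) :* (N :* T))) refl
                 (sgn (n +ℕ e)) (ℕ→ℚ (n !)) σ (w (suc m′)) T ⟩
    w (suc m′) * ((sgn (n +ℕ e) * σ) * (ℕ→ℚ (n !) * T))
      ≡⟨ cong (λ x → w (suc m′) * (x * (ℕ→ℚ (n !) * T))) (sgn-shift n e (suc m′) e≤m) ⟩
    w (suc m′) * (sgn (n +ℕ suc m′) * (ℕ→ℚ (n !) * T))
      ≡⟨ cong (w (suc m′) *_) (stirling-nörlund n′ m′ m′≤n′) ⟩
    w (suc m′) * S₁ℚ n (suc m′) ∎
    where
    σ T : ℚ
    σ = sgn (suc m′ ∸ e)
    T = Σ[ suc m′ ⋯ n ] (λ a → nörlundTerm n a m′)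

-- C_n^(k) = n! [tⁿ] Σ_m L^m / (m! (m+1)^k) = Σ_m S₁(n,m)/(m+1)^k
poly-cauchy-stirling : ∀ k n → polyCauchy n k ≡ Σ[ 0 ⋯ n ] (λ m → S₁ℚ n m * recipPow (m +ℕ 1) k)
poly-cauchy-stirling k n = trans (Σ-range-*ˡ 0 n (ℕ→ℚ (n !)) (λ m → Lif k m * (log1p ^PS m) n))
  (Σ-range-cong 0 n (λ m _ _ → begin
    ℕ→ℚ (n !) * (recip (m !) * recipPow (suc m) k * (log1p ^PS m) n)
      ≡⟨ solve 4 (λ N i r x → N :* (i :* r :* x) := i :* r :* (N :* x)) refl
                 (ℕ→ℚ (n !)) (recip (m !)) (recipPow (suc m) k) ((log1p ^PS m) n) ⟩
    recip (m !) * recipPow (suc m) k * (ℕ→ℚ (n !) * (log1p ^PS m) n)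
      ≡⟨ cong (recip (m !) * recipPow (suc m) k *_) (log-power-coefficient m n) ⟩
    recip (m !) * recipPow (suc m) k * (ℕ→ℚ (m !) * S₁ℚ n m)
      ≡⟨ solve 4 (λ i r M s → i :* r :* (M :* s) := (i :* M) :* (s :* r)) refl
                 (recip (m !)) (recipPow (suc m) k) (ℕ→ℚ (m !)) (S₁ℚ n m) ⟩
    (recip (m !) * ℕ→ℚ (m !)) * (S₁ℚ n m * recipPow (suc m) k)
      ≡⟨ cong₂ (λ u z → u * (S₁ℚ n m * recipPow z k)) (recip-fact-inverse m) (ℕP.+-comm 1 m) ⟩
    1ℚ * (S₁ℚ n m * recipPow (m +ℕ 1) k)
      ≡⟨ *-identityˡ _ ⟩
    S₁ℚ n m * recipPow (m +ℕ 1) k ∎))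
  where open ≡-Reasoning

chain : ∀ {x y z : ℚ} → x ≡ y → x ≡ z → x ≡ y × y ≡ z
chain x≡y x≡z = x≡y , trans (sym x≡y) x≡z

stirling-sum-identities :
  ∀ (k : ℤ) (n j : ℕ) → 1 ≤ n → 1 ≤ j → j ≤ n →
    let lhs = Σ[ j ⋯ n ] (λ m → binℚ m j * recipPow (m ∸ j +ℕ 1) k * S₁ℚ n m)
        mid = Σ[ 0 ⋯ n ∸ j ] (λ l → Σtuples n l (λ ls →
                multinom n l ls * binℚ (n ∸ l) j * prodB ls
                  * recipPow (n ∸ l ∸ j +ℕ 1) k))
        rhs = sgn (n +ℕ j) * ℕ→ℚ (n !) * Σ[ j ⋯ n ] (λ a → Σ[ j ∸ 1 ⋯ a ∸ 1 ] (λ l →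
                sgn (l +ℕ 1 ∸ j) * ((+ 1) ÷ℕ (a !)) * binℚ (n ∸ 1) (a ∸ 1)
                  * binℚ (a ∸ 1) l * binℚ (l +ℕ 1) j * Bord (a ∸ 1 ∸ l) a
                  * recipPow (l +ℕ 2 ∸ j) k))
    in lhs ≡ mid × mid ≡ rhs
stirling-sum-identities k n (suc j′) _ 1≤j j≤n =
  chain (trans (tuple-expansion w n j 1≤j j≤n) mid-form)
        (trans (nörlund-expansion w n j j 1≤j j≤n ℕP.≤-refl)
               (cong (sgn (n +ℕ j) * ℕ→ℚ (n !) *_)
                     (Σ-range-cong j n (λ a _ _ → Σ-range-cong j′ (a ∸ 1) (λ l j′≤l _ → rhs-term a l (s≤s j′≤l))))))
  where
  j : ℕ
  j = suc j′
  w : ℕ → ℚ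
  w m = binℚ m j * recipPow (m ∸ j +ℕ 1) k
  mid-form : Σ[ 0 ⋯ n ∸ j ] (λ l → Σtuples n l (λ ls → multinom n l ls * prodB ls * w (n ∸ l)))
           ≡ Σ[ 0 ⋯ n ∸ j ] (λ l → Σtuples n l (λ ls →
               multinom n l ls * binℚ (n ∸ l) j * prodB ls * recipPow (n ∸ l ∸ j +ℕ 1) k))
  mid-form = Σ-range-cong 0 (n ∸ j) (λ l _ _ → sum-cong (tuples n l) (λ ls →
    solve 4 (λ M P C R → M :* P :* (C :* R) := M :* C :* P :* R) refl
            (multinom n l ls) (prodB ls) (binℚ (n ∸ l) j) (recipPow (n ∸ l ∸ j +ℕ 1) k)))
  rhs-term : ∀ a l → j ≤ suc l →
    sgn (suc l ∸ j) * w (suc l) * nörlundTerm n a l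
      ≡ sgn (l +ℕ 1 ∸ j) * ((+ 1) ÷ℕ (a !)) * binℚ (n ∸ 1) (a ∸ 1)
          * binℚ (a ∸ 1) l * binℚ (l +ℕ 1) j * Bord (a ∸ 1 ∸ l) a * recipPow (l +ℕ 2 ∸ j) k
  rhs-term a l j≤l+1 = trans
    (solve 7 (λ s C R r B₁ B₂ D → s :* (C :* R) :* (r :* B₁ :* B₂ :* D) := s :* r :* B₁ :* B₂ :* C :* D :* R) refl
           (sgn (suc l ∸ j)) (binℚ (suc l) j) (recipPow (suc l ∸ j +ℕ 1) k)
           (recip (a !)) (binℚ (n ∸ 1) (a ∸ 1)) (binℚ (a ∸ 1) l) (Bord (a ∸ 1 ∸ l) a))
    (cong₂ (λ p q → sgn (p ∸ j) * recip (a !) * binℚ (n ∸ 1) (a ∸ 1) * binℚ (a ∸ 1) l * binℚ p j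
                      * Bord (a ∸ 1 ∸ l) a * recipPow q k)
           (ℕP.+-comm 1 l)
           (sym (trans (cong (_∸ j) (ℕP.+-suc l 1)) (ℕP.+-∸-comm 1 j≤l+1))))

poly-cauchy-identities :
  ∀ (k : ℤ) (n : ℕ) → 1 ≤ n →
    let e1 = Σ[ 0 ⋯ n ] (λ m → S₁ℚ n m * recipPow (m +ℕ 1) k)
        e2 = Σ[ 0 ⋯ n ∸ 1 ] (λ l → Σtuples n l (λ ls →
                multinom n l ls * prodB ls * recipPow (n ∸ l +ℕ 1) k))
        e3 = sgn n * ℕ→ℚ (n !) * Σ[ 1 ⋯ n ] (λ a → Σ[ 0 ⋯ a ∸ 1 ] (λ l →
                sgn (l +ℕ 1) * ((+ 1) ÷ℕ (a !)) * binℚ (n ∸ 1) (a ∸ 1)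
                  * binℚ (a ∸ 1) l * Bord (a ∸ 1 ∸ l) a * recipPow (l +ℕ 2) k))
    in polyCauchy n k ≡ e1 × e1 ≡ e2 × e2 ≡ e3
poly-cauchy-identities k (suc n′) 1≤n =
  poly-cauchy-stirling k n ,
  chain (trans e1-form (tuple-expansion w n 1 ℕP.≤-refl 1≤n))
        (trans e1-form (trans (nörlund-expansion w n 1 0 ℕP.≤-refl 1≤n z≤n)
               (cong₂ (λ s x → sgn s * ℕ→ℚ (n !) * x) (ℕP.+-identityʳ n)
                      (Σ-range-cong 1 n (λ a _ _ → Σ-range-cong 0 (a ∸ 1) (λ l _ _ → e3-term a l))))))
  where
  n : ℕ
  n = suc n′
  w : ℕ → ℚ
  w m = recipPow (m +ℕ 1) k
  -- the term m = 0 vanishes since S₁(n,0) = 0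
  e1-form : Σ[ 0 ⋯ n ] (λ m → S₁ℚ n m * w m) ≡ Σ[ 1 ⋯ n ] (λ m → w m * S₁ℚ n m)
  e1-form = trans (Σ-range-from 1 n (λ m → S₁ℚ n m * w m) (s≤s z≤n) (λ { zero _ → *-zeroˡ (w 0) ; (suc _) (s≤s ()) }))
                  (Σ-range-cong 1 n (λ m _ _ → *-comm (S₁ℚ n m) (w m)))
  e3-term : ∀ a l →
    sgn (suc l) * w (suc l) * nörlundTerm n a l
      ≡ sgn (l +ℕ 1) * ((+ 1) ÷ℕ (a !)) * binℚ (n ∸ 1) (a ∸ 1)
          * binℚ (a ∸ 1) l * Bord (a ∸ 1 ∸ l) a * recipPow (l +ℕ 2) k
  e3-term a l = trans
    (solve 6 (λ s R r B₁ B₂ D → s :* R :* (r :* B₁ :* B₂ :* D) := s :* r :* B₁ :* B₂ :* D :* R) refl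
           (sgn (suc l)) (w (suc l)) (recip (a !)) (binℚ (n ∸ 1) (a ∸ 1)) (binℚ (a ∸ 1) l) (Bord (a ∸ 1 ∸ l) a))
    (cong₂ (λ p q → sgn p * recip (a !) * binℚ (n ∸ 1) (a ∸ 1) * binℚ (a ∸ 1) l * Bord (a ∸ 1 ∸ l) a * recipPow q k)
           (ℕP.+-comm 1 l) (sym (ℕP.+-suc l 1)))

theorem2 :
  (∀ (k : ℤ) (n j : ℕ) → 1 ≤ n → 1 ≤ j → j ≤ n →
    let lhs = Σ[ j ⋯ n ] (λ m → binℚ m j * recipPow (m ∸ j +ℕ 1) k * S₁ℚ n m)
        mid = Σ[ 0 ⋯ n ∸ j ] (λ l → Σtuples n l (λ ls →
                multinom n l ls * binℚ (n ∸ l) j * prodB ls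
                  * recipPow (n ∸ l ∸ j +ℕ 1) k))
        rhs = sgn (n +ℕ j) * ℕ→ℚ (n !) * Σ[ j ⋯ n ] (λ a → Σ[ j ∸ 1 ⋯ a ∸ 1 ] (λ l →
                sgn (l +ℕ 1 ∸ j) * ((+ 1) ÷ℕ (a !)) * binℚ (n ∸ 1) (a ∸ 1)
                  * binℚ (a ∸ 1) l * binℚ (l +ℕ 1) j * Bord (a ∸ 1 ∸ l) a
                  * recipPow (l +ℕ 2 ∸ j) k))
    in lhs ≡ mid × mid ≡ rhs)
  ×
  (∀ (k : ℤ) (n : ℕ) → 1 ≤ n →
    let e1 = Σ[ 0 ⋯ n ] (λ m → S₁ℚ n m * recipPow (m +ℕ 1) k)
        e2 = Σ[ 0 ⋯ n ∸ 1 ] (λ l → Σtuples n l (λ ls →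
                multinom n l ls * prodB ls * recipPow (n ∸ l +ℕ 1) k))
        e3 = sgn n * ℕ→ℚ (n !) * Σ[ 1 ⋯ n ] (λ a → Σ[ 0 ⋯ a ∸ 1 ] (λ l →
                sgn (l +ℕ 1) * ((+ 1) ÷ℕ (a !)) * binℚ (n ∸ 1) (a ∸ 1)
                  * binℚ (a ∸ 1) l * Bord (a ∸ 1 ∸ l) a * recipPow (l +ℕ 2) k))
    in polyCauchy n k ≡ e1 × e1 ≡ e2 × e2 ≡ e3)
theorem2 = stirling-sum-identities , poly-cauchy-identities
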